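{- Let $q$ and $n$ be odd and $A,B\in\mathbb F_{q^n}$ with $A\ne0$. Then \[\sum_{w\in\mathbb F_{q^n}}\chi(Aw^{q+1}+Bw)=\eta(A)G\chi\left(-\frac{\lambda(A^sB^q)^{q+1}}{4\prod_{i=0}^{n-1}A^{q^i}}\right),\] where $s=\sum_{i=1}^\frac{n-1}2q^{2i}$.
   Context: $q$ is a prime power, $\mathbb F_{q^n}$ the finite field of order $q^n$. $\chi$ is the canonical additive character of $\mathbb F_{q^n}$, $\eta$ is the quadratic character of $\mathbb F_{q^n}$ with $\eta(0)=0$, $G=\sum_{c\in\mathbb F_{q^n}^*}\eta(c)\chi(c)$ is the corresponding quadratic Gauss sum, and $\lambda(x)=\sum_{i=0}^{n-1}(-1)^{i+1}x^{q^{2i}}$. -}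

module Defs where

open import Level using (Level; _⊔_) renaming (suc to lsuc)
open import Data.Nat as ℕ using (ℕ; zero; suc)
open import Data.List using (List; []; _∷_; length; foldr; upTo; filter; map)
open import Data.List.Membership.Propositional using (_∈_)
open import Data.List.Relation.Unary.Unique.Propositional using (Unique)
open import Data.List.Relation.Unary.Any using (any?)
open import Data.Product using (Σ; _,_)
open import Relation.Nullary using (¬_; Dec; yes; no)
open import Relation.Binary.PropositionalEquality using (_≡_; _≢_)
open import Relation.Binary.Definitions using (DecidableEquality)
open import Algebra.Structures using (IsCommutativeRing)
open import Algebra.Bundles using (CommutativeRing)

-- s = Σ_{i=1}^{k} q^{2i}   (used with k = (n-1)/2)
sExp : (q k : ℕ) → ℕ
sExp q zero    = 0
sExp q (suc k) = q ℕ.^ (2 ℕ.* suc k) ℕ.+ sExp q k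

record FiniteField : Set₁ where
  infixl 7 _*_
  infixl 6 _+_
  field
    Carrier   : Set
    _+_ _*_   : Carrier → Carrier → Carrier
    -_        : Carrier → Carrier
    0# 1#     : Carrier
    isCommutativeRing : IsCommutativeRing _≡_ _+_ _*_ -_ 0# 1#
    _⁻¹       : Carrier → Carrier       -- value at 0# is irrelevant
    0≢1       : 0# ≢ 1#
    inverseʳ  : ∀ x → x ≢ 0# → x * (x ⁻¹) ≡ 1#
    _≟_       : DecidableEquality Carrier
    elements  : List Carrier
    complete  : ∀ x → x ∈ elements
    unique    : Unique elements

  size : ℕ
  size = length elements

  _^_ : Carrier → ℕ → Carrier
  x ^ zero  = 1#
  x ^ suc k = x * (x ^ k)

  fromℕ : ℕ → Carrier
  fromℕ zero    = 0#
  fromℕ (suc k) = 1# + fromℕ k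

  Σ< : ℕ → (ℕ → Carrier) → Carrier
  Σ< k f = foldr (λ i acc → f i + acc) 0# (upTo k)

  Π< : ℕ → (ℕ → Carrier) → Carrier
  Π< k f = foldr (λ i acc → f i * acc) 1# (upTo k)

  sign : ℕ → Carrier
  sign zero    = 1#
  sign (suc k) = - sign k

  absTrace : (p e : ℕ) → Carrier → Carrier
  absTrace p e x = Σ< e (λ i → x ^ (p ℕ.^ i))

  -- the natural number k < p with k·1 = Tr(x)  (Tr(x) lies in F_p)
  findℕ : List ℕ → Carrier → ℕ
  findℕ []       y = 0
  findℕ (k ∷ ks) y with fromℕ k ≟ y
  ... | yes _ = k
  ... | no  _ = findℕ ks y

  traceℕ : (p e : ℕ) → Carrier → ℕ
  traceℕ p e x = findℕ (upTo p) (absTrace p e x)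

  lam : (q n : ℕ) → Carrier → Carrier
  lam q n x = Σ< n (λ i → sign (suc i) * (x ^ (q ℕ.^ (2 ℕ.* i))))

-- We let them live in an arbitrary
-- commutative ring R with a chosen element ζ satisfying
-- 1 + ζ + … + ζ^{p-1} = 0 (so ζ is a "primitive p-th root of unity";
-- for R = ℂ, ζ = exp(2πi/p) this is the paper's setting, and since
-- Z[ζ_p] = Z[x]/(Φ_p) is the universal such ring, the statement for all
-- such R is equivalent to the statement in ℂ).

module Characters {c ℓ : Level} (R : CommutativeRing c ℓ) (F : FiniteField) where
  open CommutativeRing R renaming
    (Carrier to Rc; _+_ to _+ᴿ_; _*_ to _*ᴿ_; -_ to -ᴿ_; 0# to 0ᴿ; 1# to 1ᴿ)
  open FiniteField F

  _^ᴿ_ : Rc → ℕ → Rc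
  x ^ᴿ zero  = 1ᴿ
  x ^ᴿ suc k = x *ᴿ (x ^ᴿ k)

  ΣF : (Carrier → Rc) → Rc
  ΣF f = foldr (λ x acc → f x +ᴿ acc) 0ᴿ elements

  geomSum : Rc → ℕ → Rc
  geomSum ζ k = foldr (λ i acc → (ζ ^ᴿ i) +ᴿ acc) 0ᴿ (upTo k)

  χ : (p e : ℕ) (ζ : Rc) → Carrier → Rc
  χ p e ζ x = ζ ^ᴿ traceℕ p e x

  η : Carrier → Rc
  η x with x ≟ 0#
  ... | yes _ = 0ᴿ
  ... | no  _ with any? (λ y → (y * y) ≟ x) elements
  ...   | yes _ = 1ᴿ
  ...   | no  _ = -ᴿ 1ᴿ

  -- quadratic Gauss sum  G = Σ_{c ∈ F^*} η(c) χ(c)   (η(0) = 0)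
  gauss : (p e : ℕ) (ζ : Rc) → Rc
  gauss p e ζ = ΣF (λ x → η x *ᴿ χ p e ζ x)

-- With φ(x) = x^q, the cross terms of A (w + y)^(q+1) = A φ(w + y) (w + y)
-- have trace Tr ((A y + A^q φ²(y)) φ(w)), and y = - A^t λ(A^s B^q) / (2 N(A)), with N the norm to
-- F_q and t = q + q³ + … + q^(n-2), solves A y + A^q φ²(y) = B^q because φ² shifts the alternating
-- sum λ by one term.  Hence χ(A w^(q+1) + B w) = χ(A (w + y)^(q+1)) χ(- A y^(q+1)), and
-- - A y^(q+1) is the stated argument of χ.  After the translation w ↦ w + y it remains to compute
-- Σ_w χ(A w^(q+1)): since n is odd, w ↦ w^(q+1) is two-to-one onto the nonzero squares, so the sum
-- is Σ_c (1 + η(c)) χ(A c) = η(A) G, by orthogonality of χ and multiplicativity of η.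

module Submission where

open import Defs
open import Level using (Level)
open import Data.Nat as ℕ using (ℕ; zero; suc; _≤_; _<_; _∸_; z≤n; s≤s; _⊔_; _!)
import Data.Nat
open import Data.Nat.DivMod using (_%_; _/_; m/n*n≡m; m≡m%n+[m/n]*n; m%n<n; m*n%n≡0)
open import Data.Nat.Divisibility using (_∣_; _∤_; divides; ∣⇒≤; ∣1⇒≡1; m∣m*n; n∣m*n; ∣n⇒∣m*n; ∣m+n∣m⇒∣n)
open import Data.Nat.Tactic.RingSolver using (solve-∀)
open import Data.Nat.Primality using (Prime; euclidsLemma; ¬prime[1]; prime⇒nonZero; prime⇒nonTrivial; prime⇒irreducible)
open import Data.Nat.Coprimality using (Coprime; coprime-Bézout)
open import Data.Nat.GCD using (module Bézout)
open import Data.Nat.Combinatorics using (_C_; nCn≡1; nCk≡n!/k![n-k]!; k![n∸k]!∣n!)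
open import Data.Fin as Fin using (Fin; toℕ; inject₁)
import Data.Fin.Properties as FinP
import Data.Nat.Properties as ℕP
open import Data.Integer as ℤ using (ℤ; -[1+_]; _⊖_; ∣_∣; _◃_) renaming (+_ to pos)
import Data.Integer.Properties as ℤP
open import Data.Sign as Sign using (Sign)
open import Data.Maybe using (Maybe; just; nothing)
open import Data.List using (List; []; _∷_; length; map; foldr; filter; applyUpTo; upTo)
open import Data.List.Properties using (foldr-map; length-applyUpTo)
open import Data.List.Membership.Propositional using (_∈_; _∉_; find; lose)
open import Data.List.Membership.Propositional.Properties
  using (∈-map⁺; ∈-map⁻; ∈-filter⁺; ∈-filter⁻; ∈-applyUpTo⁻; ∈-upTo⁺; ∈-upTo⁻)
open import Data.List.Membership.Propositional.Properties.WithK using (unique∧set⇒bag)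
open import Data.List.Relation.Unary.Any using (Any; here; there; any?)
open import Data.List.Relation.Unary.All using (All; []; _∷_)
open import Data.List.Relation.Unary.Unique.Propositional using (Unique)
import Data.List.Relation.Unary.Unique.Propositional.Properties as Unique
import Data.List.Relation.Unary.AllPairs as AllPairs
import Data.List.Relation.Unary.All as All
open import Data.List.Relation.Binary.BagAndSetEquality using (∼bag⇒↭)
open import Data.List.Relation.Binary.Permutation.Propositional using (_↭_; ↭⇒↭ₛ′)
import Data.List.Relation.Binary.Permutation.Propositional.Properties as ↭
import Data.List.Relation.Binary.Permutation.Setoid.Properties as ↭ₛ
open import Function using (id; _∘_; _⇔_; mk⇔)
open import Relation.Binary.Definitions using (DecidableEquality; tri<; tri≈; tri>)
open import Data.Product using (∃; _×_; _,_; proj₁; proj₂)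
open import Data.Sum using (_⊎_; inj₁; inj₂; [_,_]′)
open import Data.Empty using (⊥-elim)
open import Relation.Nullary using (yes; no; ¬_; ¬?; Dec)
open import Relation.Nullary.Decidable using (decidable-stable)
import Relation.Binary.PropositionalEquality as ≡
open ≡ using (_≡_; _≢_; cong; cong₂; subst; subst₂)
open import Algebra.Bundles using (CommutativeMonoid; CommutativeRing)
import Algebra.Solver.Ring.AlmostCommutativeRing as ACR
import Algebra.Solver.Ring as RingSolver
import Algebra.Properties.Ring as RingProperties
import Algebra.Properties.CommutativeSemigroup as CommutativeSemigroupProperties
import Algebra.Properties.CommutativeSemiring.Binomial as Binomial
import Algebra.Properties.Semiring.Exp as SemiringExp
import Algebra.Properties.Monoid.Sum as MonoidSum
import Algebra.Properties.Monoid.Mult as MonoidMult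

module Sums {c ℓ : Level} (M : CommutativeMonoid c ℓ) where
  open CommutativeMonoid M
  open CommutativeSemigroupProperties commutativeSemigroup using (interchange)
  open import Relation.Binary.Reasoning.Setoid setoid

  ∑ : {A : Set} → (A → Carrier) → List A → Carrier
  ∑ f xs = foldr (λ x acc → f x ∙ acc) ε xs

  ∑< : ℕ → (ℕ → Carrier) → Carrier
  ∑< zero    f = ε
  ∑< (suc n) f = f 0 ∙ ∑< n (f ∘ suc)

  indicator : ∀ {p} {P : Set p} → Dec P → Carrier → Carrier
  indicator (yes _) v = v
  indicator (no _)  v = ε

  module _ {A : Set} where

    ∑-cong-∈ : ∀ {f g : A → Carrier} xs → (∀ x → x ∈ xs → f x ≈ g x) → ∑ f xs ≈ ∑ g xs
    ∑-cong-∈ []       f≈g = refl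
    ∑-cong-∈ (x ∷ xs) f≈g = ∙-cong (f≈g x (here ≡.refl)) (∑-cong-∈ xs (λ y y∈xs → f≈g y (there y∈xs)))

    ∑-cong : ∀ {f g : A → Carrier} xs → (∀ x → f x ≈ g x) → ∑ f xs ≈ ∑ g xs
    ∑-cong xs f≈g = ∑-cong-∈ xs (λ x _ → f≈g x)

    ∑-ε : ∀ (xs : List A) → ∑ (λ _ → ε) xs ≈ ε
    ∑-ε []       = refl
    ∑-ε (x ∷ xs) = trans (identityˡ _) (∑-ε xs)

    ∑-distrib : ∀ (f g : A → Carrier) xs → ∑ (λ x → f x ∙ g x) xs ≈ ∑ f xs ∙ ∑ g xs
    ∑-distrib f g []       = sym (identityˡ _)
    ∑-distrib f g (x ∷ xs) = trans (∙-congˡ (∑-distrib f g xs)) (interchange _ _ _ _)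

    ∑-↭ : ∀ (f : A → Carrier) {xs ys} → xs ↭ ys → ∑ f xs ≈ ∑ f ys
    ∑-↭ f {xs} {ys} p = begin
      ∑ f xs                  ≡⟨ foldr-map _∙_ f ε xs ⟨
      foldr _∙_ ε (map f xs)  ≈⟨ ↭ₛ.foldr-commMonoid setoid isCommutativeMonoid (↭⇒↭ₛ′ isEquivalence (↭.map⁺ f p)) ⟩
      foldr _∙_ ε (map f ys)  ≡⟨ foldr-map _∙_ f ε ys ⟩
      ∑ f ys                  ∎

    ∑-reorder : ∀ (f : A → Carrier) {xs ys} → Unique xs → Unique ys →
                (∀ {x} → x ∈ xs ⇔ x ∈ ys) → ∑ f xs ≈ ∑ f ys
    ∑-reorder f xs! ys! xs≐ys = ∑-↭ f (∼bag⇒↭ (unique∧set⇒bag xs! ys! xs≐ys))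

    ∑-map : ∀ {B : Set} (f : B → Carrier) (h : A → B) xs → ∑ f (map h xs) ≈ ∑ (f ∘ h) xs
    ∑-map f h []       = refl
    ∑-map f h (x ∷ xs) = ∙-congˡ (∑-map f h xs)

    ∑-reindex : ∀ (g : A → Carrier) {xs} (f f⁻¹ : A → A) → Unique xs →
                (∀ {x} → x ∈ xs → f x ∈ xs) → (∀ {x} → x ∈ xs → f⁻¹ x ∈ xs) →
                (∀ x → f⁻¹ (f x) ≡ x) → (∀ x → f (f⁻¹ x) ≡ x) → ∑ (g ∘ f) xs ≈ ∑ g xs
    ∑-reindex g {xs} f f⁻¹ xs! f∈ f⁻¹∈ f⁻¹∘f f∘f⁻¹ = begin
      ∑ (g ∘ f) xs    ≈⟨ ∑-map g f xs ⟨
      ∑ g (map f xs)  ≈⟨ ∑-reorder g (Unique.map⁺ f-injective xs!) xs! (mk⇔ to from) ⟩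
      ∑ g xs          ∎
      where
      f-injective : ∀ {x y} → f x ≡ f y → x ≡ y
      f-injective {x} {y} e = ≡.trans (≡.sym (f⁻¹∘f x)) (≡.trans (cong f⁻¹ e) (f⁻¹∘f y))
      to : ∀ {y} → y ∈ map f xs → y ∈ xs
      to y∈ with ∈-map⁻ f y∈
      ... | x , x∈xs , ≡.refl = f∈ x∈xs
      from : ∀ {y} → y ∈ xs → y ∈ map f xs
      from {y} y∈xs = subst (_∈ map f xs) (f∘f⁻¹ y) (∈-map⁺ f (f⁻¹∈ y∈xs))

  ∑-comm : ∀ {A B : Set} (g : A → B → Carrier) xs ys →
           ∑ (λ x → ∑ (g x) ys) xs ≈ ∑ (λ y → ∑ (λ x → g x y) xs) ys
  ∑-comm g []       ys = sym (∑-ε ys)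
  ∑-comm g (x ∷ xs) ys = trans (∙-congˡ (∑-comm g xs ys)) (sym (∑-distrib (g x) _ ys))

  indicator-cong : ∀ {p} {P : Set p} (P? : Dec P) {u v} → (P → u ≈ v) → indicator P? u ≈ indicator P? v
  indicator-cong (yes p) u≈v = u≈v p
  indicator-cong (no _)  u≈v = refl

  indicator-⇔ : ∀ {p q} {P : Set p} {Q : Set q} (P? : Dec P) (Q? : Dec Q) v → (P → Q) → (Q → P) →
                indicator P? v ≈ indicator Q? v
  indicator-⇔ (yes _) (yes _) v P→Q Q→P = refl
  indicator-⇔ (no _)  (no _)  v P→Q Q→P = refl
  indicator-⇔ (yes p) (no ¬q) v P→Q Q→P = ⊥-elim (¬q (P→Q p))
  indicator-⇔ (no ¬p) (yes q) v P→Q Q→P = ⊥-elim (¬p (Q→P q))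

  module _ {A : Set} (_≟_ : DecidableEquality A) where

    ∑-indicator-∉ : ∀ a (v : A → Carrier) xs → a ∉ xs → ∑ (λ x → indicator (x ≟ a) (v x)) xs ≈ ε
    ∑-indicator-∉ a v []       a∉ = refl
    ∑-indicator-∉ a v (x ∷ xs) a∉ with x ≟ a
    ... | yes ≡.refl = ⊥-elim (a∉ (here ≡.refl))
    ... | no _       = trans (identityˡ _) (∑-indicator-∉ a v xs (a∉ ∘ there))

    ∑-indicator : ∀ a (v : A → Carrier) xs → Unique xs → a ∈ xs → ∑ (λ x → indicator (x ≟ a) (v x)) xs ≈ v a
    ∑-indicator a v (x ∷ xs) x∷xs! (here ≡.refl) with x ≟ x
    ... | yes _ = trans (∙-congˡ (∑-indicator-∉ x v xs (Unique.Unique[x∷xs]⇒x∉xs x∷xs!))) (identityʳ _)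
    ... | no x≢x = ⊥-elim (x≢x ≡.refl)
    ∑-indicator a v (x ∷ xs) x∷xs!@(_ AllPairs.∷ xs!) (there a∈xs) with x ≟ a
    ... | yes ≡.refl = ⊥-elim (Unique.Unique[x∷xs]⇒x∉xs x∷xs! a∈xs)
    ... | no _       = trans (identityˡ _) (∑-indicator a v xs xs! a∈xs)

    ∑-fibres : ∀ {B : Set} (f : B → A) (g : B → Carrier) (xs : List B) (ys : List A) → Unique ys →
               (∀ x → x ∈ xs → f x ∈ ys) →
               ∑ g xs ≈ ∑ (λ y → ∑ (λ x → indicator (f x ≟ y) (g x)) xs) ys
    ∑-fibres f g xs ys ys! f∈ys = begin
      ∑ g xs                                               ≈⟨ ∑-cong-∈ xs (λ x x∈ → sym (∑-indicator (f x) (λ _ → g x) ys ys! (f∈ys x x∈))) ⟩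
      ∑ (λ x → ∑ (λ y → indicator (y ≟ f x) (g x)) ys) xs  ≈⟨ ∑-cong xs (λ x → ∑-cong ys (λ y →
                                                               indicator-⇔ (y ≟ f x) (f x ≟ y) (g x) ≡.sym ≡.sym)) ⟩
      ∑ (λ x → ∑ (λ y → indicator (f x ≟ y) (g x)) ys) xs  ≈⟨ ∑-comm _ xs ys ⟩
      ∑ (λ y → ∑ (λ x → indicator (f x ≟ y) (g x)) xs) ys  ∎

  ∑<-cong : ∀ {f g} n → (∀ k → k < n → f k ≈ g k) → ∑< n f ≈ ∑< n g
  ∑<-cong zero    f≈g = refl
  ∑<-cong (suc n) f≈g = ∙-cong (f≈g 0 (s≤s z≤n)) (∑<-cong n (λ k k<n → f≈g (suc k) (s≤s k<n)))

  ∑<-snoc : ∀ n f → ∑< (suc n) f ≈ ∑< n f ∙ f n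
  ∑<-snoc zero    f = trans (identityʳ _) (sym (identityˡ _))
  ∑<-snoc (suc n) f = trans (∙-congˡ (∑<-snoc n (f ∘ suc))) (sym (assoc _ _ _))

  ∑<-distrib : ∀ n f g → ∑< n (λ k → f k ∙ g k) ≈ ∑< n f ∙ ∑< n g
  ∑<-distrib zero    f g = sym (identityˡ ε)
  ∑<-distrib (suc n) f g = trans (∙-congˡ (∑<-distrib n (f ∘ suc) (g ∘ suc))) (interchange _ _ _ _)

  foldr-applyUpTo : ∀ (f : ℕ → Carrier) (h : ℕ → ℕ) n →
                    foldr (λ i acc → f i ∙ acc) ε (applyUpTo h n) ≡ ∑< n (f ∘ h)
  foldr-applyUpTo f h zero    = ≡.refl
  foldr-applyUpTo f h (suc n) = cong (f (h 0) ∙_) (foldr-applyUpTo f (h ∘ suc) n)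

module ℕSum = Sums ℕP.+-0-commutativeMonoid

module RingSums {c ℓ : Level} (R : CommutativeRing c ℓ) where
  open CommutativeRing R
  open Sums +-commutativeMonoid public
  open RingProperties ring using (-‿anti-homo-+; -0#≈0#)

  ∑-distribˡ : ∀ {A : Set} v (f : A → Carrier) xs → ∑ (λ x → v * f x) xs ≈ v * ∑ f xs
  ∑-distribˡ v f []       = sym (zeroʳ v)
  ∑-distribˡ v f (x ∷ xs) = trans (+-congˡ (∑-distribˡ v f xs)) (sym (distribˡ _ _ _))

  ∑-distribʳ : ∀ {A : Set} (f : A → Carrier) v xs → ∑ (λ x → f x * v) xs ≈ ∑ f xs * v
  ∑-distribʳ f v []       = sym (zeroˡ v)
  ∑-distribʳ f v (x ∷ xs) = trans (+-congˡ (∑-distribʳ f v xs)) (sym (distribʳ _ _ _))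

  ∑<-distribˡ : ∀ v n f → ∑< n (λ k → v * f k) ≈ v * ∑< n f
  ∑<-distribˡ v zero    f = sym (zeroʳ v)
  ∑<-distribˡ v (suc n) f = trans (+-congˡ (∑<-distribˡ v n (f ∘ suc))) (sym (distribˡ _ _ _))

  ∑<-neg : ∀ n f → ∑< n (λ k → - f k) ≈ - ∑< n f
  ∑<-neg zero    f = sym -0#≈0#
  ∑<-neg (suc n) f = trans (+-congˡ (∑<-neg n (f ∘ suc))) (trans (+-comm _ _) (sym (-‿anti-homo-+ _ _)))

  indicator-* : ∀ {p} {P : Set p} (P? : Dec P) v → indicator P? v ≈ indicator P? 1# * v
  indicator-* (yes _) v = sym (*-identityˡ v)
  indicator-* (no _)  v = sym (zeroˡ v)

module Signs {c ℓ : Level} (R : CommutativeRing c ℓ) where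
  open CommutativeRing R
  open RingProperties ring using (-‿involutive; -‿distribˡ-*)
  open import Relation.Binary.Reasoning.Setoid setoid

  fromSign : Sign → Carrier
  fromSign Sign.+ = 1#
  fromSign Sign.- = - 1#

  fromSign-* : ∀ s t → fromSign (s Sign.* t) ≈ fromSign s * fromSign t
  fromSign-* Sign.+ t      = sym (*-identityˡ _)
  fromSign-* Sign.- Sign.+ = sym (*-identityʳ _)
  fromSign-* Sign.- Sign.- = begin
    1#             ≈⟨ -‿involutive 1# ⟨
    - - 1#         ≈⟨ -‿cong (*-identityˡ _) ⟨
    - (1# * - 1#)  ≈⟨ -‿distribˡ-* _ _ ⟩
    - 1# * - 1#    ∎

module Field (F : FiniteField) where
  open FiniteField F public
  open ≡ using (refl; sym; trans)

  commutativeRing : CommutativeRing _ _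
  commutativeRing = record { isCommutativeRing = isCommutativeRing }

  open CommutativeRing commutativeRing public using
    (+-assoc; +-comm; *-assoc; *-comm; +-identityˡ; +-identityʳ; *-identityˡ; *-identityʳ;
     -‿inverseʳ; distribˡ; distribʳ; zeroˡ; zeroʳ; ring)
  open RingProperties ring public
    using (-‿involutive; -‿distribˡ-*; -‿anti-homo-+; -0#≈0#; +-cancelˡ; +-cancelʳ; x∙y⁻¹≈ε⇒x≈y)
  open Signs commutativeRing public
  open ≡.≡-Reasoning

  infixl 6 _-_
  _-_ : Carrier → Carrier → Carrier
  x - y = x + - y

  fromℕ-+ : ∀ m n → fromℕ (m ℕ.+ n) ≡ fromℕ m + fromℕ n
  fromℕ-+ zero    n = sym (+-identityˡ _)
  fromℕ-+ (suc m) n = trans (cong (1# +_) (fromℕ-+ m n)) (sym (+-assoc _ _ _))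

  fromℕ-* : ∀ m n → fromℕ (m ℕ.* n) ≡ fromℕ m * fromℕ n
  fromℕ-* zero    n = sym (zeroˡ _)
  fromℕ-* (suc m) n = begin
    fromℕ (n ℕ.+ m ℕ.* n)             ≡⟨ fromℕ-+ n (m ℕ.* n) ⟩
    fromℕ n + fromℕ (m ℕ.* n)         ≡⟨ cong₂ _+_ (sym (*-identityˡ _)) (fromℕ-* m n) ⟩
    1# * fromℕ n + fromℕ m * fromℕ n  ≡⟨ sym (distribʳ _ _ _) ⟩
    (1# + fromℕ m) * fromℕ n          ∎

  open CommutativeSemigroupProperties (CommutativeRing.*-commutativeSemigroup commutativeRing) using (interchange)

  -- The ring solver takes integer coefficients through this map ℤ → F, which sends 1 to 1#
  -- on the nose so that the solver's constant 1 is the 1# of the goals.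
  private
    fromℕ⁺ : ℕ → Carrier
    fromℕ⁺ 1 = 1#
    fromℕ⁺ n = fromℕ n

    fromℕ⁺≡fromℕ : ∀ n → fromℕ⁺ n ≡ fromℕ n
    fromℕ⁺≡fromℕ zero          = refl
    fromℕ⁺≡fromℕ (suc zero)    = sym (+-identityʳ 1#)
    fromℕ⁺≡fromℕ (suc (suc n)) = refl

    fromℤ : ℤ → Carrier
    fromℤ (pos n)  = fromℕ⁺ n
    fromℤ -[1+ n ] = - fromℕ⁺ (suc n)

    fromℤ-pos : ∀ n → fromℤ (pos n) ≡ fromℕ n
    fromℤ-pos = fromℕ⁺≡fromℕ

    fromℤ-negsuc : ∀ n → fromℤ -[1+ n ] ≡ - fromℕ (suc n)
    fromℤ-negsuc n = cong -_ (fromℕ⁺≡fromℕ (suc n))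

    fromℤ-⊖ : ∀ m n → fromℤ (m ⊖ n) ≡ fromℕ m - fromℕ n
    fromℤ-⊖ m zero = begin
      fromℤ (m ⊖ 0)  ≡⟨ cong fromℤ (ℤP.⊖-≥ {m} {0} z≤n) ⟩
      fromℤ (pos m)  ≡⟨ fromℤ-pos m ⟩
      fromℕ m        ≡⟨ sym (+-identityʳ _) ⟩
      fromℕ m + 0#   ≡⟨ cong (fromℕ m +_) (sym -0#≈0#) ⟩
      fromℕ m - 0#   ∎
    fromℤ-⊖ zero    (suc n) = trans (fromℤ-negsuc n) (sym (+-identityˡ _))
    fromℤ-⊖ (suc m) (suc n) = begin
      fromℤ (suc m ⊖ suc n)            ≡⟨ cong fromℤ (ℤP.[1+m]⊖[1+n]≡m⊖n m n) ⟩
      fromℤ (m ⊖ n)                    ≡⟨ fromℤ-⊖ m n ⟩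
      fromℕ m - fromℕ n                ≡⟨ cancel (fromℕ m) (fromℕ n) ⟩
      (1# + fromℕ m) - (1# + fromℕ n)  ∎
      where
      cancel : ∀ a b → a - b ≡ (1# + a) - (1# + b)
      cancel a b = begin
        a - b                  ≡⟨ sym (+-identityˡ _) ⟩
        0# + (a - b)           ≡⟨ cong (_+ (a - b)) (sym (-‿inverseʳ 1#)) ⟩
        (1# - 1#) + (a - b)    ≡⟨ +-assoc _ _ _ ⟩
        1# + (- 1# + (a - b))  ≡⟨ cong (1# +_) (sym (+-assoc _ _ _)) ⟩
        1# + ((- 1# + a) - b)  ≡⟨ cong (λ z → 1# + (z - b)) (+-comm _ _) ⟩
        1# + ((a - 1#) - b)    ≡⟨ cong (1# +_) (+-assoc _ _ _) ⟩
        1# + (a + (- 1# - b))  ≡⟨ cong (λ z → 1# + (a + z)) (sym (-‿anti-homo-+ b 1#)) ⟩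
        1# + (a - (b + 1#))    ≡⟨ cong (λ z → 1# + (a - z)) (+-comm b 1#) ⟩
        1# + (a - (1# + b))    ≡⟨ sym (+-assoc _ _ _) ⟩
        (1# + a) - (1# + b)    ∎

    fromℤ-◃ : ∀ s n → fromℤ (s ◃ n) ≡ fromSign s * fromℕ n
    fromℤ-◃ s       zero    = sym (zeroʳ _)
    fromℤ-◃ Sign.+ (suc n) = trans (fromℤ-pos (suc n)) (sym (*-identityˡ _))
    fromℤ-◃ Sign.- (suc n) =
      trans (fromℤ-negsuc n) (trans (cong -_ (sym (*-identityˡ _))) (-‿distribˡ-* _ _))

    fromℤ-sign-abs : ∀ i → fromℤ i ≡ fromSign (ℤ.sign i) * fromℕ ∣ i ∣
    fromℤ-sign-abs i = trans (cong fromℤ (sym (ℤP.◃-inverse i))) (fromℤ-◃ (ℤ.sign i) ∣ i ∣)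

    fromℤ-* : ∀ i j → fromℤ (i ℤ.* j) ≡ fromℤ i * fromℤ j
    fromℤ-* i j = begin
      fromℤ (ℤ.sign i Sign.* ℤ.sign j ◃ ∣ i ∣ ℕ.* ∣ j ∣)
        ≡⟨ fromℤ-◃ (ℤ.sign i Sign.* ℤ.sign j) (∣ i ∣ ℕ.* ∣ j ∣) ⟩
      fromSign (ℤ.sign i Sign.* ℤ.sign j) * fromℕ (∣ i ∣ ℕ.* ∣ j ∣)
        ≡⟨ cong₂ _*_ (fromSign-* (ℤ.sign i) (ℤ.sign j)) (fromℕ-* ∣ i ∣ ∣ j ∣) ⟩
      (fromSign (ℤ.sign i) * fromSign (ℤ.sign j)) * (fromℕ ∣ i ∣ * fromℕ ∣ j ∣)
        ≡⟨ interchange _ _ _ _ ⟩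
      (fromSign (ℤ.sign i) * fromℕ ∣ i ∣) * (fromSign (ℤ.sign j) * fromℕ ∣ j ∣)
        ≡⟨ sym (cong₂ _*_ (fromℤ-sign-abs i) (fromℤ-sign-abs j)) ⟩
      fromℤ i * fromℤ j ∎

    fromℤ-neg : ∀ i → fromℤ (ℤ.- i) ≡ - fromℤ i
    fromℤ-neg (pos zero)    = sym -0#≈0#
    fromℤ-neg (pos (suc n)) = refl
    fromℤ-neg -[1+ n ]      = sym (-‿involutive _)

    fromℤ-+ : ∀ i j → fromℤ (i ℤ.+ j) ≡ fromℤ i + fromℤ j
    fromℤ-+ -[1+ m ] -[1+ n ] = begin
      fromℤ -[1+ suc (m ℕ.+ n) ]         ≡⟨ fromℤ-negsuc (suc (m ℕ.+ n)) ⟩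
      - fromℕ (suc (suc (m ℕ.+ n)))      ≡⟨ cong (λ z → - fromℕ (suc z)) (sym (ℕP.+-suc m n)) ⟩
      - fromℕ (suc m ℕ.+ suc n)          ≡⟨ cong -_ (fromℕ-+ (suc m) (suc n)) ⟩
      - (fromℕ (suc m) + fromℕ (suc n))  ≡⟨ -‿anti-homo-+ _ _ ⟩
      - fromℕ (suc n) + - fromℕ (suc m)  ≡⟨ +-comm _ _ ⟩
      - fromℕ (suc m) + - fromℕ (suc n)  ≡⟨ sym (cong₂ _+_ (fromℤ-negsuc m) (fromℤ-negsuc n)) ⟩
      fromℤ -[1+ m ] + fromℤ -[1+ n ]    ∎
    fromℤ-+ -[1+ m ] (pos n) =
      trans (fromℤ-⊖ n (suc m)) (trans (+-comm _ _) (sym (cong₂ _+_ (fromℤ-negsuc m) (fromℤ-pos n))))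
    fromℤ-+ (pos m) -[1+ n ] =
      trans (fromℤ-⊖ m (suc n)) (sym (cong₂ _+_ (fromℤ-pos m) (fromℤ-negsuc n)))
    fromℤ-+ (pos m) (pos n) =
      trans (fromℤ-pos (m ℕ.+ n)) (trans (fromℕ-+ m n) (sym (cong₂ _+_ (fromℤ-pos m) (fromℤ-pos n))))

    almostCommutativeRing : ACR.AlmostCommutativeRing _ _
    almostCommutativeRing = ACR.fromCommutativeRing commutativeRing

    fromℤ-morphism : ℤ.+-*-rawRing ACR.-Raw-AlmostCommutative⟶ almostCommutativeRing
    fromℤ-morphism = record
      { ⟦_⟧ = fromℤ ; +-homo = fromℤ-+ ; *-homo = fromℤ-* ; -‿homo = fromℤ-neg
      ; 0-homo = refl ; 1-homo = refl }

    fromℤ-≟ : ∀ i j → Maybe (fromℤ i ≡ fromℤ j)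
    fromℤ-≟ i j with i ℤ.≟ j
    ... | yes refl = just refl
    ... | no _     = nothing

  open RingSolver ℤ.+-*-rawRing almostCommutativeRing fromℤ-morphism fromℤ-≟ public
    using (solve; _:=_; _:+_; _:*_; :-_; _:-_; con)

  1≢0 : 1# ≢ 0#
  1≢0 e = 0≢1 (sym e)

  inverseˡ : ∀ x → x ≢ 0# → x ⁻¹ * x ≡ 1#
  inverseˡ x x≢0 = trans (*-comm _ _) (inverseʳ x x≢0)

  *-cancelˡ : ∀ a {x y} → a ≢ 0# → a * x ≡ a * y → x ≡ y
  *-cancelˡ a {x} {y} a≢0 e = begin
    x               ≡⟨ sym (*-identityˡ x) ⟩
    1# * x          ≡⟨ cong (_* x) (sym (inverseˡ a a≢0)) ⟩
    (a ⁻¹ * a) * x  ≡⟨ *-assoc _ _ _ ⟩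
    a ⁻¹ * (a * x)  ≡⟨ cong (a ⁻¹ *_) e ⟩
    a ⁻¹ * (a * y)  ≡⟨ sym (*-assoc _ _ _) ⟩
    (a ⁻¹ * a) * y  ≡⟨ cong (_* y) (inverseˡ a a≢0) ⟩
    1# * y          ≡⟨ *-identityˡ y ⟩
    y               ∎

  zero-product : ∀ x y → x * y ≡ 0# → x ≡ 0# ⊎ y ≡ 0#
  zero-product x y e with x ≟ 0#
  ... | yes x≡0 = inj₁ x≡0
  ... | no  x≢0 = inj₂ (*-cancelˡ x x≢0 (trans e (sym (zeroʳ x))))

  *-nonzero : ∀ {x y} → x ≢ 0# → y ≢ 0# → x * y ≢ 0#
  *-nonzero {x} {y} x≢0 y≢0 e with zero-product x y e
  ... | inj₁ x≡0 = x≢0 x≡0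
  ... | inj₂ y≡0 = y≢0 y≡0

  ⁻¹-nonzero : ∀ x → x ≢ 0# → x ⁻¹ ≢ 0#
  ⁻¹-nonzero x x≢0 e = 1≢0 (trans (sym (inverseʳ x x≢0)) (trans (cong (x *_) e) (zeroʳ x)))

  ⁻¹-unique : ∀ z u → z * u ≡ 1# → u ≡ z ⁻¹
  ⁻¹-unique z u zu≡1 = *-cancelˡ z z≢0 (trans zu≡1 (sym (inverseʳ z z≢0)))
    where
    z≢0 : z ≢ 0#
    z≢0 z≡0 = 1≢0 (trans (sym zu≡1) (trans (cong (_* u) z≡0) (zeroˡ u)))

  inverse-cancel : ∀ {a b} → a * b ≡ 1# → ∀ y → a * (b * y) ≡ y
  inverse-cancel {a} {b} ab≡1 y = trans (sym (*-assoc a b y)) (trans (cong (_* y) ab≡1) (*-identityˡ y))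

  -‿square : ∀ a → (- a) * (- a) ≡ a * a
  -‿square = solve 1 (λ a → (:- a) :* (:- a) := a :* a) refl

  square-roots : ∀ {x a} → x * x ≡ a * a → x ≡ a ⊎ x ≡ - a
  square-roots {x} {a} e with zero-product (x - a) (x + a) (begin
      (x - a) * (x + a)  ≡⟨ solve 2 (λ x a → (x :- a) :* (x :+ a) := x :* x :- a :* a) refl x a ⟩
      x * x - a * a      ≡⟨ cong (_- a * a) e ⟩
      a * a - a * a      ≡⟨ -‿inverseʳ _ ⟩
      0#                 ∎)
  ... | inj₁ x-a≡0 = inj₁ (x∙y⁻¹≈ε⇒x≈y x a x-a≡0)
  ... | inj₂ x+a≡0 = inj₂ (x∙y⁻¹≈ε⇒x≈y x (- a) (trans (solve 2 (λ x a → x :- (:- a) := x :+ a) refl x a) x+a≡0))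

  ^-homo-* : ∀ x m n → x ^ (m ℕ.+ n) ≡ x ^ m * x ^ n
  ^-homo-* x zero    n = sym (*-identityˡ _)
  ^-homo-* x (suc m) n = trans (cong (x *_) (^-homo-* x m n)) (sym (*-assoc _ _ _))

  ^-distrib-* : ∀ x y n → (x * y) ^ n ≡ x ^ n * y ^ n
  ^-distrib-* x y zero    = sym (*-identityˡ 1#)
  ^-distrib-* x y (suc n) = trans (cong ((x * y) *_) (^-distrib-* x y n)) (interchange _ _ _ _)

  1^n≡1 : ∀ n → 1# ^ n ≡ 1#
  1^n≡1 zero    = refl
  1^n≡1 (suc n) = trans (*-identityˡ _) (1^n≡1 n)

  x^1≡x : ∀ x → x ^ 1 ≡ x
  x^1≡x = *-identityʳ

  ^-assocʳ : ∀ x m n → (x ^ m) ^ n ≡ x ^ (m ℕ.* n)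
  ^-assocʳ x zero    n = 1^n≡1 n
  ^-assocʳ x (suc m) n = begin
    (x * x ^ m) ^ n        ≡⟨ ^-distrib-* x (x ^ m) n ⟩
    x ^ n * (x ^ m) ^ n    ≡⟨ cong (x ^ n *_) (^-assocʳ x m n) ⟩
    x ^ n * x ^ (m ℕ.* n)  ≡⟨ sym (^-homo-* x n (m ℕ.* n)) ⟩
    x ^ (n ℕ.+ m ℕ.* n)    ∎

  ^-comm : ∀ x m n → (x ^ m) ^ n ≡ (x ^ n) ^ m
  ^-comm x m n = trans (^-assocʳ x m n) (trans (cong (x ^_) (ℕP.*-comm m n)) (sym (^-assocʳ x n m)))

  ^-nonzero : ∀ x n → x ≢ 0# → x ^ n ≢ 0#
  ^-nonzero x zero    x≢0 = 1≢0
  ^-nonzero x (suc n) x≢0 = *-nonzero x≢0 (^-nonzero x n x≢0)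

  ^≡0⇒≡0 : ∀ x n → x ^ n ≡ 0# → x ≡ 0#
  ^≡0⇒≡0 x n e with x ≟ 0#
  ... | yes x≡0 = x≡0
  ... | no  x≢0 = ⊥-elim (^-nonzero x n x≢0 e)

  fromℕ-^ : ∀ k n → fromℕ (k ℕ.^ n) ≡ fromℕ k ^ n
  fromℕ-^ k zero    = +-identityʳ 1#
  fromℕ-^ k (suc n) = trans (fromℕ-* k (k ℕ.^ n)) (cong (fromℕ k *_) (fromℕ-^ k n))

  -‿^-even : ∀ x k → (- x) ^ (2 ℕ.* k) ≡ x ^ (2 ℕ.* k)
  -‿^-even x k = begin
    (- x) ^ (2 ℕ.* k)  ≡⟨ sym (^-assocʳ (- x) 2 k) ⟩
    ((- x) ^ 2) ^ k    ≡⟨ cong (_^ k) (solve 1 (λ x → (:- x) :* ((:- x) :* con (pos 1)) := x :* (x :* con (pos 1))) refl x) ⟩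
    (x ^ 2) ^ k        ≡⟨ ^-assocʳ x 2 k ⟩
    x ^ (2 ℕ.* k)      ∎

  0^n≡0 : ∀ {n} → 0 < n → 0# ^ n ≡ 0#
  0^n≡0 {suc n} _ = zeroˡ _

  ^-fixed-^ : ∀ {y n} → y ^ n ≡ y → ∀ i → y ^ (n ℕ.^ i) ≡ y
  ^-fixed-^ {y} {n} yⁿ≡y zero    = x^1≡x y
  ^-fixed-^ {y} {n} yⁿ≡y (suc i) = begin
    y ^ (n ℕ.* n ℕ.^ i)  ≡⟨ sym (^-assocʳ y n (n ℕ.^ i)) ⟩
    (y ^ n) ^ (n ℕ.^ i)  ≡⟨ cong (_^ (n ℕ.^ i)) yⁿ≡y ⟩
    y ^ (n ℕ.^ i)        ≡⟨ ^-fixed-^ yⁿ≡y i ⟩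
    y                    ∎

  ⁻¹-fixed-^ : ∀ {y} n → y ≢ 0# → y ^ n ≡ y → (y ⁻¹) ^ n ≡ y ⁻¹
  ⁻¹-fixed-^ {y} n y≢0 yⁿ≡y = *-cancelˡ y y≢0 (begin
    y * (y ⁻¹) ^ n      ≡⟨ cong (_* (y ⁻¹) ^ n) (sym yⁿ≡y) ⟩
    y ^ n * (y ⁻¹) ^ n  ≡⟨ sym (^-distrib-* y (y ⁻¹) n) ⟩
    (y * y ⁻¹) ^ n      ≡⟨ cong (_^ n) (inverseʳ y y≢0) ⟩
    1# ^ n              ≡⟨ 1^n≡1 n ⟩
    1#                  ≡⟨ sym (inverseʳ y y≢0) ⟩
    y * y ⁻¹            ∎)

  private
    open CommutativeRing commutativeRing using (semiring; commutativeSemiring; +-monoid)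
    open SemiringExp semiring using () renaming (_^_ to _^ˢ_)
    open MonoidSum +-monoid using (sum; sum-cong-≋; sum-init-last; sum-replicate-zero)
    module Binom = Binomial commutativeSemiring

    ^≡^ˢ : ∀ x n → x ^ n ≡ x ^ˢ n
    ^≡^ˢ x zero    = refl
    ^≡^ˢ x (suc n) = cong (x *_) (^≡^ˢ x n)

    open MonoidMult +-monoid using () renaming (_×_ to _·_)

    ·≡fromℕ* : ∀ n x → n · x ≡ fromℕ n * x
    ·≡fromℕ* zero    x = sym (zeroˡ x)
    ·≡fromℕ* (suc n) x = trans (cong₂ _+_ (sym (*-identityˡ x)) (·≡fromℕ* n x)) (sym (distribʳ x 1# (fromℕ n)))

  freshman's-dream : ∀ n → 0 < n → (∀ k → 0 < k → k < n → fromℕ (n C k) ≡ 0#) →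
                     ∀ x y → (x + y) ^ n ≡ x ^ n + y ^ n
  freshman's-dream (suc m) _ inner-vanish x y = begin
    (x + y) ^ n
      ≡⟨ ^≡^ˢ (x + y) n ⟩
    (x + y) ^ˢ n
      ≡⟨ Binom.theorem n x y ⟩
    term Fin.zero + sum (term ∘ Fin.suc)
      ≡⟨ cong (term Fin.zero +_) (sum-init-last (term ∘ Fin.suc)) ⟩
    term Fin.zero + (sum inner + term (Fin.suc (Fin.fromℕ m)))
      ≡⟨ cong₂ (λ a b → term Fin.zero + (a + b)) inner≡0 last≡x^n ⟩
    term Fin.zero + (0# + x ^ n)
      ≡⟨ cong (_+ (0# + x ^ n)) first≡y^n ⟩
    y ^ n + (0# + x ^ n)
      ≡⟨ solve 2 (λ a b → b :+ (con (pos 0) :+ a) := a :+ b) refl (x ^ n) (y ^ n) ⟩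
    x ^ n + y ^ n ∎
    where
    n = suc m
    term : Fin (suc n) → Carrier
    term = Binom.binomialTerm x y n
    inner : Fin m → Carrier
    inner i = term (Fin.suc (inject₁ i))
    inner≡0 : sum inner ≡ 0#
    inner≡0 = trans (sum-cong-≋ (λ i → vanish (suc (toℕ (inject₁ i))) (s≤s z≤n)
                                         (s≤s (subst (_< m) (sym (FinP.toℕ-inject₁ i)) (FinP.toℕ<n i))) _))
                    (sum-replicate-zero m)
      where
      vanish : ∀ k → 0 < k → k < n → ∀ z → (n C k) · z ≡ 0#
      vanish k 0<k k<n z = trans (·≡fromℕ* (n C k) z) (trans (cong (_* z) (inner-vanish k 0<k k<n)) (zeroˡ z))
    last≡x^n : term (Fin.suc (Fin.fromℕ m)) ≡ x ^ n
    last≡x^n rewrite FinP.toℕ-fromℕ m | nCn≡1 n | ℕP.n∸n≡0 m =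
      trans (+-identityʳ _) (trans (*-identityʳ _) (sym (^≡^ˢ x n)))
    first≡y^n : term Fin.zero ≡ y ^ n
    first≡y^n = trans (+-identityʳ _) (trans (*-identityˡ _) (sym (^≡^ˢ y n)))

  findℕ-spec : ∀ ks y → (∃ λ k → k ∈ ks × fromℕ k ≡ y) → findℕ ks y ∈ ks × fromℕ (findℕ ks y) ≡ y
  findℕ-spec []       y (k , () , _)
  findℕ-spec (k ∷ ks) y found with fromℕ k ≟ y
  ... | yes k≡y = here refl , k≡y
  findℕ-spec (k ∷ ks) y (k′ , here refl , k′≡y) | no k≢y = ⊥-elim (k≢y k′≡y)
  findℕ-spec (k ∷ ks) y (k′ , there k′∈ , k′≡y) | no k≢y =
    let (found∈ , found≡y) = findℕ-spec ks y (k′ , k′∈ , k′≡y) in there found∈ , found≡y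

  open RingSums commutativeRing public
  module Product = Sums (CommutativeRing.*-commutativeMonoid commutativeRing)

  ∑-1# : ∀ {A : Set} (xs : List A) → ∑ (λ _ → 1#) xs ≡ fromℕ (length xs)
  ∑-1# []       = refl
  ∑-1# (x ∷ xs) = cong (1# +_) (∑-1# xs)

  ∏-scale : ∀ {A : Set} x (f : A → Carrier) xs → Product.∑ (λ y → x * f y) xs ≡ x ^ length xs * Product.∑ f xs
  ∏-scale x f []       = sym (*-identityˡ 1#)
  ∏-scale x f (y ∷ xs) = trans (cong (x * f y *_) (∏-scale x f xs)) (interchange _ _ _ _)

  ∏-nonzero : ∀ xs → (∀ {y} → y ∈ xs → y ≢ 0#) → Product.∑ id xs ≢ 0#
  ∏-nonzero []       nz = 1≢0
  ∏-nonzero (x ∷ xs) nz = *-nonzero (nz (here refl)) (∏-nonzero xs (nz ∘ there))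

  nonzeros : List Carrier
  nonzeros = filter (λ x → ¬? (x ≟ 0#)) elements

  nonzeros! : Unique nonzeros
  nonzeros! = Unique.filter⁺ _ unique

  ∈-nonzeros : ∀ {x} → x ≢ 0# → x ∈ nonzeros
  ∈-nonzeros {x} x≢0 = ∈-filter⁺ (λ x → ¬? (x ≟ 0#)) (complete x) x≢0

  nonzeros-nonzero : ∀ {x} → x ∈ nonzeros → x ≢ 0#
  nonzeros-nonzero x∈ = proj₂ (∈-filter⁻ (λ x → ¬? (x ≟ 0#)) {xs = elements} x∈)

  elements↭0∷nonzeros : elements ↭ 0# ∷ nonzeros
  elements↭0∷nonzeros = ∼bag⇒↭ (unique∧set⇒bag unique 0∷nonzeros! (mk⇔ to from))
    where
    0∷nonzeros! : Unique (0# ∷ nonzeros)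
    0∷nonzeros! = All.tabulate (λ x∈ 0≡x → nonzeros-nonzero x∈ (sym 0≡x)) AllPairs.∷ nonzeros!
    to : ∀ {x} → x ∈ elements → x ∈ 0# ∷ nonzeros
    to {x} _ with x ≟ 0#
    ... | yes x≡0 = here x≡0
    ... | no  x≢0 = there (∈-nonzeros x≢0)
    from : ∀ {x} → x ∈ 0# ∷ nonzeros → x ∈ elements
    from {x} _ = complete x

  size≡1+∣nonzeros∣ : size ≡ suc (length nonzeros)
  size≡1+∣nonzeros∣ = ↭.↭-length elements↭0∷nonzeros

  x^∣nonzeros∣≡1 : ∀ x → x ≢ 0# → x ^ length nonzeros ≡ 1#
  x^∣nonzeros∣≡1 x x≢0 = *-cancelˡ P (∏-nonzero nonzeros nonzeros-nonzero) (begin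
    P * x ^ length nonzeros    ≡⟨ *-comm _ _ ⟩
    x ^ length nonzeros * P    ≡⟨ sym (∏-scale x id nonzeros) ⟩
    Product.∑ (x *_) nonzeros  ≡⟨ Product.∑-reindex id (x *_) (x ⁻¹ *_) nonzeros!
                                          (∈-nonzeros ∘ *-nonzero x≢0 ∘ nonzeros-nonzero)
                                          (∈-nonzeros ∘ *-nonzero (⁻¹-nonzero x x≢0) ∘ nonzeros-nonzero)
                                          (inverse-cancel (inverseˡ x x≢0)) (inverse-cancel (inverseʳ x x≢0)) ⟩
    P                          ≡⟨ sym (*-identityʳ P) ⟩
    P * 1#                     ∎)
    where
    P = Product.∑ id nonzeros

  x^size≡x : ∀ x → x ^ size ≡ x
  x^size≡x x with x ≟ 0#
  ... | yes refl = subst (λ n → 0# ^ n ≡ 0#) (sym size≡1+∣nonzeros∣) (zeroˡ _)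
  ... | no  x≢0  = subst (λ n → x ^ n ≡ x) (sym size≡1+∣nonzeros∣)
                     (trans (cong (x *_) (x^∣nonzeros∣≡1 x x≢0)) (*-identityʳ x))

  fromℕ-size≡0 : fromℕ size ≡ 0#
  fromℕ-size≡0 = +-cancelˡ S _ _ (begin
    S + fromℕ size             ≡⟨ cong (S +_) (sym (∑-1# elements)) ⟩
    S + ∑ (λ _ → 1#) elements  ≡⟨ sym (∑-distrib id (λ _ → 1#) elements) ⟩
    ∑ (λ y → y + 1#) elements  ≡⟨ ∑-reindex id (_+ 1#) (_- 1#) unique (λ _ → complete _) (λ _ → complete _)
                                                  (solve 1 (λ y → (y :+ con (pos 1)) :- con (pos 1) := y) refl)
                                                  (solve 1 (λ y → (y :- con (pos 1)) :+ con (pos 1) := y) refl) ⟩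
    S                          ≡⟨ sym (+-identityʳ S) ⟩
    S + 0#                     ∎)
    where S = ∑ id elements

module Polynomials (F : FiniteField) where
  open Field F
  open ≡ using (refl; sym; trans)
  open ≡.≡-Reasoning

  -- Coefficient lists, constant term first.
  Poly : Set
  Poly = List Carrier

  eval : Poly → Carrier → Carrier
  eval []       x = 0#
  eval (c ∷ f) x = c + x * eval f x

  coeff : Poly → ℕ → Carrier
  coeff []      i       = 0#
  coeff (c ∷ f) zero    = c
  coeff (c ∷ f) (suc i) = coeff f i

  IsZero : Poly → Set
  IsZero f = All (_≡ 0#) f

  divide : Carrier → Poly → Poly × Carrier
  divide r []          = [] , 0#
  divide r (c ∷ [])    = [] , c
  divide r (c ∷ d ∷ f) = let (g , s) = divide r (d ∷ f) in (s ∷ g) , c + r * s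

  eval-divide : ∀ r f x → eval f x ≡ (x - r) * eval (proj₁ (divide r f)) x + proj₂ (divide r f)
  eval-divide r []          x = sym (trans (+-identityʳ _) (zeroʳ _))
  eval-divide r (c ∷ [])    x = solve 3 (λ c x r → c :+ x :* con (pos 0) := (x :- r) :* con (pos 0) :+ c) refl c x r
  eval-divide r (c ∷ d ∷ f) x = begin
    c + x * eval (d ∷ f) x               ≡⟨ cong (λ z → c + x * z) (eval-divide r (d ∷ f) x) ⟩
    c + x * ((x - r) * g + s)            ≡⟨ solve 5 (λ c x r g s → c :+ x :* ((x :- r) :* g :+ s) := (x :- r) :* (s :+ x :* g) :+ (c :+ r :* s)) refl c x r g s ⟩
    (x - r) * (s + x * g) + (c + r * s)  ∎
    where
    g = eval (proj₁ (divide r (d ∷ f))) x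
    s = proj₂ (divide r (d ∷ f))

  length-divide : ∀ r c f → length (proj₁ (divide r (c ∷ f))) ≡ length f
  length-divide r c []      = refl
  length-divide r c (d ∷ f) = cong suc (length-divide r d f)

  divide-isZero : ∀ r f → IsZero (proj₁ (divide r f)) → proj₂ (divide r f) ≡ 0# → IsZero f
  divide-isZero r []          _           _    = []
  divide-isZero r (c ∷ [])    _           c≡0  = c≡0 ∷ []
  divide-isZero r (c ∷ d ∷ f) (s≡0 ∷ g≡0) rem≡0 = c≡0 ∷ divide-isZero r (d ∷ f) g≡0 s≡0
    where
    c≡0 : c ≡ 0#
    c≡0 = trans (sym (trans (cong (λ z → c + r * z) s≡0) (trans (cong (c +_) (zeroʳ r)) (+-identityʳ c)))) rem≡0

  many-roots⇒isZero : ∀ (rs : List Carrier) (f : Poly) → Unique rs → All (λ r → eval f r ≡ 0#) rs →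
                      length f ≤ length rs → IsZero f
  many-roots⇒isZero rs       []      _  _ _ = []
  many-roots⇒isZero []       (c ∷ f) _  _ ()
  many-roots⇒isZero (r ∷ rs) (c ∷ f) (r∉rs AllPairs.∷ rs!) (fr≡0 ∷ roots) (s≤s f≤rs) =
    divide-isZero r (c ∷ f) g≡0 rem≡0
    where
    g = proj₁ (divide r (c ∷ f))
    rem = proj₂ (divide r (c ∷ f))
    rem≡0 : rem ≡ 0#
    rem≡0 = begin
      rem                       ≡⟨ sym (+-identityˡ rem) ⟩
      0# + rem                  ≡⟨ cong (_+ rem) (sym (trans (cong (_* eval g r) (-‿inverseʳ r)) (zeroˡ _))) ⟩
      (r - r) * eval g r + rem  ≡⟨ sym (eval-divide r (c ∷ f) r) ⟩
      eval (c ∷ f) r            ≡⟨ fr≡0 ⟩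
      0#                        ∎
    g-root : ∀ {r′} → r′ ∈ rs → eval (c ∷ f) r′ ≡ 0# → eval g r′ ≡ 0#
    g-root {r′} r′∈rs fr′≡0 with zero-product (r′ - r) (eval g r′)
        (trans (sym (+-identityʳ _)) (trans (cong ((r′ - r) * eval g r′ +_) (sym rem≡0)) (trans (sym (eval-divide r (c ∷ f) r′)) fr′≡0)))
    ... | inj₂ gr′≡0 = gr′≡0
    ... | inj₁ r′-r≡0 = ⊥-elim (All.lookup r∉rs r′∈rs (sym (x∙y⁻¹≈ε⇒x≈y r′ r r′-r≡0)))
    g≡0 : IsZero g
    g≡0 = many-roots⇒isZero rs g rs! (All.tabulate (λ r′∈ → g-root r′∈ (All.lookup roots r′∈)))
            (subst (_≤ length rs) (sym (length-divide r c f)) f≤rs)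

  coeff-isZero : ∀ f i → IsZero f → coeff f i ≡ 0#
  coeff-isZero []      i       _          = refl
  coeff-isZero (c ∷ f) zero    (c≡0 ∷ _)  = c≡0
  coeff-isZero (c ∷ f) (suc i) (_ ∷ f≡0)  = coeff-isZero f i f≡0

  roots<length : ∀ (f : Poly) i rs → coeff f i ≢ 0# → Unique rs → All (λ r → eval f r ≡ 0#) rs →
                 length rs < length f
  roots<length f i rs fᵢ≢0 rs! roots with length f ℕP.≤? length rs
  ... | yes f≤rs = ⊥-elim (fᵢ≢0 (coeff-isZero f i (many-roots⇒isZero rs f rs! roots f≤rs)))
  ... | no  f≰rs = ℕP.≰⇒> f≰rs

  coeff-≥length : ∀ f i → length f ≤ i → coeff f i ≡ 0#
  coeff-≥length []      i       _         = refl
  coeff-≥length (c ∷ f) (suc i) (s≤s f≤i) = coeff-≥length f i f≤i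

  infixl 6 _⊕_
  _⊕_ : Poly → Poly → Poly
  []      ⊕ g       = g
  (a ∷ f) ⊕ []      = a ∷ f
  (a ∷ f) ⊕ (b ∷ g) = (a + b) ∷ (f ⊕ g)

  eval-⊕ : ∀ f g x → eval (f ⊕ g) x ≡ eval f x + eval g x
  eval-⊕ []      g       x = sym (+-identityˡ _)
  eval-⊕ (a ∷ f) []      x = sym (+-identityʳ _)
  eval-⊕ (a ∷ f) (b ∷ g) x = trans (cong (λ z → (a + b) + x * z) (eval-⊕ f g x))
    (solve 5 (λ a b x u v → (a :+ b) :+ x :* (u :+ v) := (a :+ x :* u) :+ (b :+ x :* v)) refl a b x (eval f x) (eval g x))

  coeff-⊕ : ∀ f g i → coeff (f ⊕ g) i ≡ coeff f i + coeff g i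
  coeff-⊕ []      g       i       = sym (+-identityˡ _)
  coeff-⊕ (a ∷ f) []      zero    = sym (+-identityʳ _)
  coeff-⊕ (a ∷ f) []      (suc i) = sym (+-identityʳ _)
  coeff-⊕ (a ∷ f) (b ∷ g) zero    = refl
  coeff-⊕ (a ∷ f) (b ∷ g) (suc i) = coeff-⊕ f g i

  length-⊕ : ∀ f g → length (f ⊕ g) ≡ length f ⊔ length g
  length-⊕ []      g       = refl
  length-⊕ (a ∷ f) []      = refl
  length-⊕ (a ∷ f) (b ∷ g) = cong suc (length-⊕ f g)

  monomial : ℕ → Carrier → Poly
  monomial zero    c = c ∷ []
  monomial (suc k) c = 0# ∷ monomial k c

  eval-monomial : ∀ k c x → eval (monomial k c) x ≡ c * x ^ k
  eval-monomial zero    c x = solve 2 (λ c x → c :+ x :* con (pos 0) := c :* con (pos 1)) refl c x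
  eval-monomial (suc k) c x = trans (cong (λ z → 0# + x * z) (eval-monomial k c x))
    (solve 3 (λ c x y → con (pos 0) :+ x :* (c :* y) := c :* (x :* y)) refl c x (x ^ k))

  length-monomial : ∀ k c → length (monomial k c) ≡ suc k
  length-monomial zero    c = refl
  length-monomial (suc k) c = cong suc (length-monomial k c)

  coeff-monomial : ∀ k c → coeff (monomial k c) k ≡ c
  coeff-monomial zero    c = refl
  coeff-monomial (suc k) c = coeff-monomial k c

  coeff-monomial-≢ : ∀ k c i → i ≢ k → coeff (monomial k c) i ≡ 0#
  coeff-monomial-≢ zero    c zero    i≢k = ⊥-elim (i≢k refl)
  coeff-monomial-≢ zero    c (suc i) i≢k = refl
  coeff-monomial-≢ (suc k) c zero    i≢k = refl
  coeff-monomial-≢ (suc k) c (suc i) i≢k = coeff-monomial-≢ k c i (i≢k ∘ cong suc)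

  ∣roots[X^k-X^j]∣≤k : ∀ {j k} → j < k → ∀ rs → Unique rs → All (λ r → r ^ k ≡ r ^ j) rs → length rs ≤ k
  ∣roots[X^k-X^j]∣≤k {j} {k} j<k rs rs! roots =
    ℕP.<⇒≤pred (subst (length rs <_) length-P (roots<length P k rs P[k]≢0 rs! (All.map root roots)))
    where
    P = monomial k 1# ⊕ monomial j (- 1#)
    root : ∀ {x} → x ^ k ≡ x ^ j → eval P x ≡ 0#
    root {x} x^k≡x^j = begin
      eval P x
        ≡⟨ eval-⊕ (monomial k 1#) _ x ⟩
      eval (monomial k 1#) x + eval (monomial j (- 1#)) x
        ≡⟨ cong₂ _+_ (eval-monomial k 1# x) (eval-monomial j (- 1#) x) ⟩
      1# * x ^ k + - 1# * x ^ j
        ≡⟨ solve 2 (λ a b → con (pos 1) :* a :+ (:- con (pos 1)) :* b := a :- b) refl (x ^ k) (x ^ j) ⟩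
      x ^ k - x ^ j
        ≡⟨ cong (_- x ^ j) x^k≡x^j ⟩
      x ^ j - x ^ j
        ≡⟨ -‿inverseʳ _ ⟩
      0# ∎
    P[k]≢0 : coeff P k ≢ 0#
    P[k]≢0 e = 1≢0 (begin
      1#                                                     ≡⟨ sym (+-identityʳ 1#) ⟩
      1# + 0#                                                ≡⟨ sym (cong₂ _+_ (coeff-monomial k 1#) (coeff-monomial-≢ j (- 1#) k (ℕP.>⇒≢ j<k))) ⟩
      coeff (monomial k 1#) k + coeff (monomial j (- 1#)) k  ≡⟨ sym (coeff-⊕ (monomial k 1#) _ k) ⟩
      coeff P k                                              ≡⟨ e ⟩
      0#                                                     ∎)
    length-P : length P ≡ suc k
    length-P = trans (length-⊕ (monomial k 1#) _)
      (trans (cong₂ _⊔_ (length-monomial k 1#) (length-monomial j (- 1#))) (ℕP.m≥n⇒m⊔n≡m (s≤s (ℕP.<⇒≤ j<k))))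

prime∤! : ∀ {p} → Prime p → ∀ {m} → m < p → p ∤ m !
prime∤! p-prime {zero}  _   p∣1 = ¬prime[1] (subst Prime (∣1⇒≡1 p∣1) p-prime)
prime∤! p-prime {suc m} m<p p∣m! with euclidsLemma (suc m) (m !) p-prime p∣m!
... | inj₁ p∣1+m = ℕP.<⇒≱ m<p (∣⇒≤ p∣1+m)
... | inj₂ p∣m!  = prime∤! p-prime (ℕP.<-trans (ℕP.n<1+n m) m<p) p∣m!

prime∣C : ∀ {p} → Prime p → ∀ {k} → 0 < k → k < p → p ∣ p C k
prime∣C {p@(suc p-1)} p-prime {k} 0<k k<p
  with euclidsLemma (p C k) (k ! ℕ.* (p ∸ k) !) p-prime p∣C*k![p-k]!
  where
  p∣C*k![p-k]! : p ∣ (p C k) ℕ.* (k ! ℕ.* (p ∸ k) !)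
  p∣C*k![p-k]! = subst (p ∣_) (≡.sym C*k![p-k]!≡p!) (m∣m*n (p-1 !))
    where
    instance _ = k ℕP.!* (p ∸ k) !≢0
    C*k![p-k]!≡p! : (p C k) ℕ.* (k ! ℕ.* (p ∸ k) !) ≡ p !
    C*k![p-k]!≡p! = ≡.trans (cong (ℕ._* (k ! ℕ.* (p ∸ k) !)) (nCk≡n!/k![n-k]! (ℕP.<⇒≤ k<p)))
                            (m/n*n≡m (k![n∸k]!∣n! (ℕP.<⇒≤ k<p)))
... | inj₁ p∣C = p∣C
... | inj₂ p∣k![p-k]! with euclidsLemma (k !) ((p ∸ k) !) p-prime p∣k![p-k]!
...   | inj₁ p∣k!     = ⊥-elim (prime∤! p-prime k<p p∣k!)
...   | inj₂ p∣[p-k]! = ⊥-elim (prime∤! p-prime (ℕP.∸-monoʳ-< 0<k (ℕP.<⇒≤ k<p)) p∣[p-k]!)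

module PrimeCharacteristic (F : FiniteField) (p : ℕ) (p-prime : Prime p) (E : ℕ)
                           (size≡p^E : FiniteField.size F ≡ p ℕ.^ E) where
  open Field F
  open Polynomials F
  open ≡ using (refl; sym; trans)
  open ≡.≡-Reasoning

  instance
    p≢0 : ℕ.NonZero p
    p≢0 = prime⇒nonZero p-prime

  1<p : 1 < p
  1<p = ℕ.nonTrivial⇒n>1 p {{prime⇒nonTrivial p-prime}}

  fromℕ-p≡0 : fromℕ p ≡ 0#
  fromℕ-p≡0 = ^≡0⇒≡0 (fromℕ p) E (begin
    fromℕ p ^ E      ≡⟨ sym (fromℕ-^ p E) ⟩
    fromℕ (p ℕ.^ E)  ≡⟨ cong fromℕ (sym size≡p^E) ⟩
    fromℕ size       ≡⟨ fromℕ-size≡0 ⟩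
    0#               ∎)

  fromℕ-*p≡0 : ∀ a → fromℕ (a ℕ.* p) ≡ 0#
  fromℕ-*p≡0 a = trans (fromℕ-* a p) (trans (cong (fromℕ a *_) fromℕ-p≡0) (zeroʳ _))

  fromℕ-%p : ∀ a → fromℕ a ≡ fromℕ (a % p)
  fromℕ-%p a = begin
    fromℕ a                                ≡⟨ cong fromℕ (m≡m%n+[m/n]*n a p) ⟩
    fromℕ (a % p ℕ.+ (a / p) ℕ.* p)        ≡⟨ fromℕ-+ (a % p) _ ⟩
    fromℕ (a % p) + fromℕ ((a / p) ℕ.* p)  ≡⟨ cong (fromℕ (a % p) +_) (fromℕ-*p≡0 (a / p)) ⟩
    fromℕ (a % p) + 0#                     ≡⟨ +-identityʳ _ ⟩
    fromℕ (a % p)                          ∎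

  fromℕ-nonzero : ∀ {k} → 0 < k → k < p → fromℕ k ≢ 0#
  fromℕ-nonzero {k} 0<k k<p k≡0 with coprime-Bézout k⊥p
    where
    k⊥p : Coprime k p
    k⊥p {i} (i∣k , i∣p) with prime⇒irreducible p-prime i∣p
    ... | inj₁ i≡1 = i≡1
    ... | inj₂ refl = ⊥-elim (ℕP.<⇒≱ k<p (∣⇒≤ {{ℕ.>-nonZero 0<k}} i∣k))
  ... | Bézout.+- x y 1+yp≡xk = 1≢0 (begin
    1#                     ≡⟨ sym (+-identityʳ 1#) ⟩
    1# + 0#                ≡⟨ cong (1# +_) (sym (fromℕ-*p≡0 y)) ⟩
    fromℕ (1 ℕ.+ y ℕ.* p)  ≡⟨ cong fromℕ 1+yp≡xk ⟩
    fromℕ (x ℕ.* k)        ≡⟨ fromℕ-* x k ⟩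
    fromℕ x * fromℕ k      ≡⟨ cong (fromℕ x *_) k≡0 ⟩
    fromℕ x * 0#           ≡⟨ zeroʳ _ ⟩
    0#                     ∎)
  ... | Bézout.-+ x y 1+xk≡yp = 1≢0 (begin
    1#                     ≡⟨ sym (+-identityʳ 1#) ⟩
    1# + 0#                ≡⟨ cong (1# +_) (sym (trans (fromℕ-* x k) (trans (cong (fromℕ x *_) k≡0) (zeroʳ _)))) ⟩
    fromℕ (1 ℕ.+ x ℕ.* k)  ≡⟨ cong fromℕ 1+xk≡yp ⟩
    fromℕ (y ℕ.* p)        ≡⟨ fromℕ-*p≡0 y ⟩
    0#                     ∎)

  fromℕ-distinct : ∀ {k l} → k < l → l < p → fromℕ k ≢ fromℕ l
  fromℕ-distinct {k} {l} k<l l<p k≡l = fromℕ-nonzero (ℕP.m<n⇒0<n∸m k<l) (ℕP.≤-<-trans (ℕP.m∸n≤m l k) l<p)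
    (+-cancelˡ (fromℕ k) _ _ (begin
      fromℕ k + fromℕ (l ∸ k)  ≡⟨ sym (fromℕ-+ k (l ∸ k)) ⟩
      fromℕ (k ℕ.+ (l ∸ k))    ≡⟨ cong fromℕ (ℕP.m+[n∸m]≡n (ℕP.<⇒≤ k<l)) ⟩
      fromℕ l                  ≡⟨ sym k≡l ⟩
      fromℕ k                  ≡⟨ sym (+-identityʳ _) ⟩
      fromℕ k + 0#             ∎))

  fromℕ-injective : ∀ {k l} → k < p → l < p → fromℕ k ≡ fromℕ l → k ≡ l
  fromℕ-injective {k} {l} k<p l<p k≡l with ℕP.<-cmp k l
  ... | tri< k<l _ _   = ⊥-elim (fromℕ-distinct k<l l<p k≡l)
  ... | tri≈ _ k≡l′ _  = k≡l′
  ... | tri> _ _ l<k   = ⊥-elim (fromℕ-distinct l<k k<p (sym k≡l))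

  frobenius : ∀ x y → (x + y) ^ p ≡ x ^ p + y ^ p
  frobenius = freshman's-dream p (ℕ.>-nonZero⁻¹ p) (λ k 0<k k<p → p∣n⇒fromℕ≡0 (prime∣C p-prime 0<k k<p))
    where
    p∣n⇒fromℕ≡0 : ∀ {n} → p ∣ n → fromℕ n ≡ 0#
    p∣n⇒fromℕ≡0 (divides d refl) = fromℕ-*p≡0 d

  frobenius-^ : ∀ i x y → (x + y) ^ (p ℕ.^ i) ≡ x ^ (p ℕ.^ i) + y ^ (p ℕ.^ i)
  frobenius-^ zero    x y = trans (x^1≡x _) (sym (cong₂ _+_ (x^1≡x x) (x^1≡x y)))
  frobenius-^ (suc i) x y = begin
    (x + y) ^ (p ℕ.* p ℕ.^ i)                  ≡⟨ sym (^-assocʳ (x + y) p (p ℕ.^ i)) ⟩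
    ((x + y) ^ p) ^ (p ℕ.^ i)                  ≡⟨ cong (_^ (p ℕ.^ i)) (frobenius x y) ⟩
    (x ^ p + y ^ p) ^ (p ℕ.^ i)                ≡⟨ frobenius-^ i (x ^ p) (y ^ p) ⟩
    (x ^ p) ^ (p ℕ.^ i) + (y ^ p) ^ (p ℕ.^ i)  ≡⟨ cong₂ _+_ (^-assocʳ x p (p ℕ.^ i)) (^-assocʳ y p (p ℕ.^ i)) ⟩
    x ^ (p ℕ.* p ℕ.^ i) + y ^ (p ℕ.* p ℕ.^ i)  ∎

  frobenius-∑< : ∀ n g → ∑< n g ^ p ≡ ∑< n (λ k → g k ^ p)
  frobenius-∑< zero    g = 0^n≡0 (ℕ.>-nonZero⁻¹ p)
  frobenius-∑< (suc n) g = trans (frobenius (g 0) _) (cong (g 0 ^ p +_) (frobenius-∑< n (g ∘ suc)))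

  fromℕ^p≡fromℕ : ∀ k → fromℕ k ^ p ≡ fromℕ k
  fromℕ^p≡fromℕ zero    = 0^n≡0 (ℕ.>-nonZero⁻¹ p)
  fromℕ^p≡fromℕ (suc k) = trans (frobenius 1# (fromℕ k)) (cong₂ _+_ (1^n≡1 p) (fromℕ^p≡fromℕ k))

  -- X^p - X already has the p roots 0, 1, …, p - 1, so it has no other.
  ^p-fixed⇒fromℕ : ∀ y → y ^ p ≡ y → ∃ λ k → k < p × fromℕ k ≡ y
  ^p-fixed⇒fromℕ y y^p≡y with any? (λ k → fromℕ k ≟ y) (upTo p)
  ... | yes found = let (k , k∈ , k≡y) = find found in k , ∈-upTo⁻ k∈ , k≡y
  ... | no ¬found = ⊥-elim (ℕP.<⇒≱ (ℕP.n<1+n p) (subst (_≤ p) (cong suc (length-applyUpTo fromℕ p))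
                      (∣roots[X^k-X^j]∣≤k 1<p (y ∷ prime-subfield) roots! roots)))
    where
    prime-subfield = applyUpTo fromℕ p
    y∉ : y ∉ prime-subfield
    y∉ y∈ with ∈-applyUpTo⁻ fromℕ y∈
    ... | k , k<p , refl = ¬found (lose (∈-upTo⁺ k<p) refl)
    roots! : Unique (y ∷ prime-subfield)
    roots! = All.tabulate (λ x∈ y≡x → y∉ (subst (_∈ prime-subfield) (sym y≡x) x∈))
             AllPairs.∷ Unique.applyUpTo⁺₁ fromℕ p (λ i<j j<p → ℕP.<⇒≢ i<j ∘ fromℕ-injective (ℕP.<-trans i<j j<p) j<p)
    roots : All (λ r → r ^ p ≡ r ^ 1) (y ∷ prime-subfield)
    roots = trans y^p≡y (sym (x^1≡x y))
          ∷ All.tabulate (λ x∈ → let (k , _ , x≡k) = ∈-applyUpTo⁻ fromℕ x∈ in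
                                   subst (λ x → x ^ p ≡ x ^ 1) (sym x≡k) (trans (fromℕ^p≡fromℕ k) (sym (x^1≡x _))))

  Tr : Carrier → Carrier
  Tr = absTrace p E

  Trℕ : Carrier → ℕ
  Trℕ = traceℕ p E

  Tr≡∑< : ∀ x → Tr x ≡ ∑< E (λ i → x ^ (p ℕ.^ i))
  Tr≡∑< x = foldr-applyUpTo (λ i → x ^ (p ℕ.^ i)) id E

  Tr-+ : ∀ x y → Tr (x + y) ≡ Tr x + Tr y
  Tr-+ x y = begin
    Tr (x + y)
      ≡⟨ Tr≡∑< (x + y) ⟩
    ∑< E (λ i → (x + y) ^ (p ℕ.^ i))
      ≡⟨ ∑<-cong E (λ i _ → frobenius-^ i x y) ⟩
    ∑< E (λ i → x ^ (p ℕ.^ i) + y ^ (p ℕ.^ i))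
      ≡⟨ ∑<-distrib E (λ i → x ^ (p ℕ.^ i)) (λ i → y ^ (p ℕ.^ i)) ⟩
    ∑< E (λ i → x ^ (p ℕ.^ i)) + ∑< E (λ i → y ^ (p ℕ.^ i))
      ≡⟨ sym (cong₂ _+_ (Tr≡∑< x) (Tr≡∑< y)) ⟩
    Tr x + Tr y ∎

  -- Frobenius permutes the summands x, x^p, …, x^(p^(E-1)) cyclically, since x^(p^E) = x.
  Tr^p≡Tr : ∀ x → Tr x ^ p ≡ Tr x
  Tr^p≡Tr x = begin
    Tr x ^ p              ≡⟨ cong (_^ p) (Tr≡∑< x) ⟩
    ∑< E f ^ p            ≡⟨ frobenius-∑< E f ⟩
    ∑< E (λ i → f i ^ p)  ≡⟨ ∑<-cong E (λ i _ → trans (^-assocʳ x (p ℕ.^ i) p) (cong (x ^_) (ℕP.*-comm (p ℕ.^ i) p))) ⟩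
    ∑< E (f ∘ suc)        ≡⟨ cyclic ⟩
    ∑< E f                ≡⟨ sym (Tr≡∑< x) ⟩
    Tr x                  ∎
    where
    f : ℕ → Carrier
    f i = x ^ (p ℕ.^ i)
    cyclic : ∑< E (f ∘ suc) ≡ ∑< E f
    cyclic = +-cancelˡ (f 0) _ _ (begin
      f 0 + ∑< E (f ∘ suc)  ≡⟨ ∑<-snoc E f ⟩
      ∑< E f + f E          ≡⟨ cong (∑< E f +_) (trans f[E]≡x (sym (x^1≡x x))) ⟩
      ∑< E f + f 0          ≡⟨ +-comm _ _ ⟩
      f 0 + ∑< E f          ∎)
      where
      f[E]≡x : f E ≡ x
      f[E]≡x = trans (cong (x ^_) (sym size≡p^E)) (x^size≡x x)

  Tr-^p : ∀ y → Tr (y ^ p) ≡ Tr y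
  Tr-^p y = begin
    Tr (y ^ p)                        ≡⟨ Tr≡∑< (y ^ p) ⟩
    ∑< E (λ i → (y ^ p) ^ (p ℕ.^ i))  ≡⟨ ∑<-cong E (λ i _ → ^-comm y p (p ℕ.^ i)) ⟩
    ∑< E (λ i → (y ^ (p ℕ.^ i)) ^ p)  ≡⟨ sym (frobenius-∑< E (λ i → y ^ (p ℕ.^ i))) ⟩
    ∑< E (λ i → y ^ (p ℕ.^ i)) ^ p    ≡⟨ cong (_^ p) (sym (Tr≡∑< y)) ⟩
    Tr y ^ p                          ≡⟨ Tr^p≡Tr y ⟩
    Tr y                              ∎

  Tr-^p^i : ∀ i y → Tr (y ^ (p ℕ.^ i)) ≡ Tr y
  Tr-^p^i zero    y = cong Tr (x^1≡x y)
  Tr-^p^i (suc i) y = begin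
    Tr (y ^ (p ℕ.* p ℕ.^ i))  ≡⟨ cong Tr (trans (sym (^-assocʳ y p (p ℕ.^ i))) (^-comm y p (p ℕ.^ i))) ⟩
    Tr ((y ^ (p ℕ.^ i)) ^ p)  ≡⟨ Tr-^p (y ^ (p ℕ.^ i)) ⟩
    Tr (y ^ (p ℕ.^ i))        ≡⟨ Tr-^p^i i y ⟩
    Tr y                      ∎

  Tr-scale : ∀ c x → c ^ p ≡ c → Tr (c * x) ≡ c * Tr x
  Tr-scale c x c^p≡c = begin
    Tr (c * x)                        ≡⟨ Tr≡∑< (c * x) ⟩
    ∑< E (λ i → (c * x) ^ (p ℕ.^ i))  ≡⟨ ∑<-cong E (λ i _ → trans (^-distrib-* c x (p ℕ.^ i)) (cong (_* x ^ (p ℕ.^ i)) (^-fixed-^ c^p≡c i))) ⟩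
    ∑< E (λ i → c * x ^ (p ℕ.^ i))    ≡⟨ ∑<-distribˡ c E (λ i → x ^ (p ℕ.^ i)) ⟩
    c * ∑< E (λ i → x ^ (p ℕ.^ i))    ≡⟨ cong (c *_) (sym (Tr≡∑< x)) ⟩
    c * Tr x                          ∎

  tracePoly : ℕ → Poly
  tracePoly zero    = []
  tracePoly (suc i) = tracePoly i ⊕ monomial (p ℕ.^ i) 1#

  eval-tracePoly : ∀ i x → eval (tracePoly i) x ≡ ∑< i (λ j → x ^ (p ℕ.^ j))
  eval-tracePoly zero    x = refl
  eval-tracePoly (suc i) x = begin
    eval (tracePoly i ⊕ monomial (p ℕ.^ i) 1#) x           ≡⟨ eval-⊕ (tracePoly i) _ x ⟩
    eval (tracePoly i) x + eval (monomial (p ℕ.^ i) 1#) x  ≡⟨ cong₂ _+_ (eval-tracePoly i x) (trans (eval-monomial (p ℕ.^ i) 1# x) (*-identityˡ _)) ⟩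
    ∑< i (λ j → x ^ (p ℕ.^ j)) + x ^ (p ℕ.^ i)             ≡⟨ sym (∑<-snoc i _) ⟩
    ∑< (suc i) (λ j → x ^ (p ℕ.^ j))                       ∎

  length-tracePoly : ∀ i → length (tracePoly i) ≤ p ℕ.^ i
  length-tracePoly zero    = z≤n
  length-tracePoly (suc i) = subst (_≤ p ℕ.^ suc i) (sym (length-⊕ (tracePoly i) (monomial (p ℕ.^ i) 1#)))
    (ℕP.⊔-lub (ℕP.≤-trans (length-tracePoly i) (ℕP.m≤n*m (p ℕ.^ i) p))
              (subst (_≤ p ℕ.^ suc i) (sym (length-monomial (p ℕ.^ i) 1#))
                     (subst (_< p ℕ.^ suc i) (ℕP.*-identityˡ (p ℕ.^ i)) (ℕP.*-monoˡ-< (p ℕ.^ i) 1<p))))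
    where instance _ = ℕP.m^n≢0 p i

  coeff-tracePoly : ∀ i → coeff (tracePoly (suc i)) (p ℕ.^ i) ≡ 1#
  coeff-tracePoly i = begin
    coeff (tracePoly i ⊕ monomial (p ℕ.^ i) 1#) (p ℕ.^ i)                    ≡⟨ coeff-⊕ (tracePoly i) _ (p ℕ.^ i) ⟩
    coeff (tracePoly i) (p ℕ.^ i) + coeff (monomial (p ℕ.^ i) 1#) (p ℕ.^ i)  ≡⟨ cong₂ _+_
                                                                                 (coeff-≥length (tracePoly i) (p ℕ.^ i) (length-tracePoly i))
                                                                                 (coeff-monomial (p ℕ.^ i) 1#) ⟩
    0# + 1#                                                                  ≡⟨ +-identityˡ 1# ⟩
    1#                                                                       ∎

  0<E : 0 < E
  0<E = positive E size≡p^E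
    where
    positive : ∀ E → size ≡ p ℕ.^ E → 0 < E
    positive zero    size≡1 with nonzeros | ∈-nonzeros 1≢0 | ℕP.suc-injective (trans (sym size≡1+∣nonzeros∣) size≡1)
    ... | _ ∷ _ | _ | ()
    positive (suc E) _ = s≤s z≤n

  tracePoly-nonzero : ∀ i → 0 < i → ∃ λ j → coeff (tracePoly i) j ≢ 0#
  tracePoly-nonzero (suc i) _ = p ℕ.^ i , λ c≡0 → 1≢0 (trans (sym (coeff-tracePoly i)) c≡0)

  -- Otherwise every element of F would be a root of tracePoly E, which has only |F| coefficients.
  ∃[Tr≢0] : ∃ λ a → Tr a ≢ 0#
  ∃[Tr≢0] with any? (λ x → ¬? (Tr x ≟ 0#)) elements
  ... | yes found = let (a , _ , Tra≢0) = find found in a , Tra≢0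
  ... | no ¬found = ⊥-elim (ℕP.<⇒≱
        (let (j , c≢0) = tracePoly-nonzero E 0<E in roots<length (tracePoly E) j elements c≢0 unique roots)
        (subst (length (tracePoly E) ≤_) (sym size≡p^E) (length-tracePoly E)))
    where
    roots : All (λ x → eval (tracePoly E) x ≡ 0#) elements
    roots = All.tabulate (λ {x} x∈ → trans (eval-tracePoly E x) (trans (sym (Tr≡∑< x))
              (decidable-stable (Tr x ≟ 0#) (λ Trx≢0 → ¬found (lose x∈ Trx≢0)))))

  ∃[Tr≡1] : ∃ λ a → Tr a ≡ 1#
  ∃[Tr≡1] = let (a , Tra≢0) = ∃[Tr≢0] in (Tr a ⁻¹ * a) , (begin
    Tr (Tr a ⁻¹ * a)  ≡⟨ Tr-scale (Tr a ⁻¹) a (⁻¹-fixed-^ p Tra≢0 (Tr^p≡Tr a)) ⟩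
    Tr a ⁻¹ * Tr a    ≡⟨ inverseˡ (Tr a) Tra≢0 ⟩
    1#                ∎)

  Trℕ-spec : ∀ x → Trℕ x < p × fromℕ (Trℕ x) ≡ Tr x
  Trℕ-spec x = let (k , k<p , k≡Trx) = ^p-fixed⇒fromℕ (Tr x) (Tr^p≡Tr x)
                   (found∈ , found≡) = findℕ-spec (upTo p) (Tr x) (k , ∈-upTo⁺ k<p , k≡Trx)
               in ∈-upTo⁻ found∈ , found≡

  Trℕ-cong : ∀ {x y} → Tr x ≡ Tr y → Trℕ x ≡ Trℕ y
  Trℕ-cong {x} {y} Trx≡Try = fromℕ-injective (proj₁ (Trℕ-spec x)) (proj₁ (Trℕ-spec y))
    (trans (proj₂ (Trℕ-spec x)) (trans Trx≡Try (sym (proj₂ (Trℕ-spec y)))))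

  Trℕ-+ : ∀ x y → Trℕ (x + y) ≡ (Trℕ x ℕ.+ Trℕ y) % p
  Trℕ-+ x y = fromℕ-injective (proj₁ (Trℕ-spec (x + y))) (m%n<n _ p) (begin
    fromℕ (Trℕ (x + y))            ≡⟨ proj₂ (Trℕ-spec (x + y)) ⟩
    Tr (x + y)                     ≡⟨ Tr-+ x y ⟩
    Tr x + Tr y                    ≡⟨ sym (cong₂ _+_ (proj₂ (Trℕ-spec x)) (proj₂ (Trℕ-spec y))) ⟩
    fromℕ (Trℕ x) + fromℕ (Trℕ y)  ≡⟨ sym (fromℕ-+ (Trℕ x) (Trℕ y)) ⟩
    fromℕ (Trℕ x ℕ.+ Trℕ y)        ≡⟨ fromℕ-%p _ ⟩
    fromℕ ((Trℕ x ℕ.+ Trℕ y) % p)  ∎)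


module Squares (F : FiniteField) (2≢0 : FiniteField.fromℕ F 2 ≢ FiniteField.0# F) where
  open Field F
  open Polynomials F
  open ≡ using (refl; sym; trans)
  open ≡.≡-Reasoning

  x≢-x : ∀ x → x ≢ 0# → x ≢ - x
  x≢-x x x≢0 x≡-x = x≢0 (*-cancelˡ (fromℕ 2) 2≢0 (begin
    fromℕ 2 * x   ≡⟨ solve 1 (λ x → (con (pos 1) :+ (con (pos 1) :+ con (pos 0))) :* x := x :+ x) refl x ⟩
    x + x         ≡⟨ cong (x +_) x≡-x ⟩
    x + - x       ≡⟨ -‿inverseʳ x ⟩
    0#            ≡⟨ sym (zeroʳ _) ⟩
    fromℕ 2 * 0#  ∎))

  1≢-1 : 1# ≢ - 1#
  1≢-1 = x≢-x 1# 1≢0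

  IsSquare : Carrier → Set
  IsSquare y = Any (λ x → x * x ≡ y) elements

  isSquare? : ∀ y → Dec (IsSquare y)
  isSquare? y = any? (λ x → (x * x) ≟ y) elements

  square-isSquare : ∀ x → IsSquare (x * x)
  square-isSquare x = lose (complete x) refl

  squareRoot : ∀ {y} → IsSquare y → ∃ λ x → x * x ≡ y
  squareRoot y□ = let (x , _ , x²≡y) = find y□ in x , x²≡y

  squares : List Carrier
  squares = filter isSquare? nonzeros

  squares! : Unique squares
  squares! = Unique.filter⁺ isSquare? nonzeros!

  ∈-squares : ∀ {y} → y ≢ 0# → IsSquare y → y ∈ squares
  ∈-squares y≢0 y□ = ∈-filter⁺ isSquare? (∈-nonzeros y≢0) y□

  squares-spec : ∀ {y} → y ∈ squares → y ≢ 0# × IsSquare y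
  squares-spec y∈ = let (y∈nonzeros , y□) = ∈-filter⁻ isSquare? {xs = nonzeros} y∈ in nonzeros-nonzero y∈nonzeros , y□

  h : ℕ
  h = length squares

  square-roots-count : ∀ y → y ∈ squares → ℕSum.∑ (λ x → ℕSum.indicator ((x * x) ≟ y) 1) nonzeros ≡ 2
  square-roots-count y y∈ with squares-spec y∈
  ... | y≢0 , y□ with squareRoot y□
  ...   | a , refl = begin
    ℕSum.∑ (λ x → ℕSum.indicator ((x * x) ≟ (a * a)) 1) nonzeros
      ≡⟨ ℕSum.∑-cong nonzeros split ⟩
    ℕSum.∑ (λ x → ℕSum.indicator (x ≟ a) 1 ℕ.+ ℕSum.indicator (x ≟ (- a)) 1) nonzeros
      ≡⟨ ℕSum.∑-distrib (λ x → ℕSum.indicator (x ≟ a) 1) (λ x → ℕSum.indicator (x ≟ (- a)) 1) nonzeros ⟩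
    ℕSum.∑ (λ x → ℕSum.indicator (x ≟ a) 1) nonzeros ℕ.+ ℕSum.∑ (λ x → ℕSum.indicator (x ≟ (- a)) 1) nonzeros
      ≡⟨ cong₂ ℕ._+_ (ℕSum.∑-indicator _≟_ a (λ _ → 1) nonzeros nonzeros! (∈-nonzeros a≢0))
                     (ℕSum.∑-indicator _≟_ (- a) (λ _ → 1) nonzeros nonzeros! (∈-nonzeros -a≢0)) ⟩
    2 ∎
    where
    a≢0 : a ≢ 0#
    a≢0 a≡0 = y≢0 (trans (cong (_* a) a≡0) (zeroˡ a))
    -a≢0 : - a ≢ 0#
    -a≢0 -a≡0 = a≢0 (trans (sym (-‿involutive a)) (trans (cong -_ -a≡0) -0#≈0#))
    split : ∀ x → ℕSum.indicator ((x * x) ≟ (a * a)) 1 ≡ ℕSum.indicator (x ≟ a) 1 ℕ.+ ℕSum.indicator (x ≟ (- a)) 1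
    split x with x ≟ a | x ≟ (- a) | (x * x) ≟ (a * a)
    ... | yes refl | yes x≡-x | _        = ⊥-elim (x≢-x x a≢0 x≡-x)
    ... | yes refl | no _     | yes _    = refl
    ... | yes refl | no _     | no x²≢x² = ⊥-elim (x²≢x² refl)
    ... | no _     | yes refl | yes _    = refl
    ... | no _     | yes refl | no x²≢a² = ⊥-elim (x²≢a² (-‿square a))
    ... | no x≢a   | no x≢-a  | yes x²≡a² = ⊥-elim ([ x≢a , x≢-a ]′ (square-roots x²≡a²))
    ... | no _     | no _     | no _     = refl

  ∣nonzeros∣≡2h : length nonzeros ≡ 2 ℕ.* h
  ∣nonzeros∣≡2h = begin
    length nonzeros
      ≡⟨ sym (count-1 nonzeros) ⟩
    ℕSum.∑ (λ _ → 1) nonzeros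
      ≡⟨ ℕSum.∑-fibres _≟_ (λ x → x * x) (λ _ → 1) nonzeros squares squares!
           (λ x x∈ → ∈-squares (*-nonzero (nonzeros-nonzero x∈) (nonzeros-nonzero x∈)) (square-isSquare x)) ⟩
    ℕSum.∑ (λ y → ℕSum.∑ (λ x → ℕSum.indicator ((x * x) ≟ y) 1) nonzeros) squares
      ≡⟨ ℕSum.∑-cong-∈ squares square-roots-count ⟩
    ℕSum.∑ (λ _ → 2) squares
      ≡⟨ count-2 squares ⟩
    2 ℕ.* h ∎
    where
    count-1 : ∀ {A : Set} (xs : List A) → ℕSum.∑ (λ _ → 1) xs ≡ length xs
    count-1 []       = refl
    count-1 (x ∷ xs) = cong suc (count-1 xs)
    count-2 : ∀ (xs : List Carrier) → ℕSum.∑ (λ _ → 2) xs ≡ 2 ℕ.* length xs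
    count-2 []       = refl
    count-2 (x ∷ xs) = trans (cong (2 ℕ.+_) (count-2 xs)) (sym (ℕP.*-distribˡ-+ 2 1 (length xs)))

  x^2h≡x^h*x^h : ∀ x → x ^ (2 ℕ.* h) ≡ x ^ h * x ^ h
  x^2h≡x^h*x^h x = trans (cong (x ^_) (cong (h ℕ.+_) (ℕP.+-identityʳ h))) (^-homo-* x h h)

  euler-square : ∀ y → y ≢ 0# → IsSquare y → y ^ h ≡ 1#
  euler-square y y≢0 y□ with squareRoot y□
  ... | a , refl = begin
    (a * a) ^ h          ≡⟨ ^-distrib-* a a h ⟩
    a ^ h * a ^ h        ≡⟨ sym (x^2h≡x^h*x^h a) ⟩
    a ^ (2 ℕ.* h)        ≡⟨ cong (a ^_) (sym ∣nonzeros∣≡2h) ⟩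
    a ^ length nonzeros  ≡⟨ x^∣nonzeros∣≡1 a (λ a≡0 → y≢0 (trans (cong (_* a) a≡0) (zeroˡ a))) ⟩
    1#                   ∎

  -- y^h = ±1 by Fermat; if it were 1, then y and the h squares would be h + 1 roots of X^h - 1.
  euler-nonsquare : ∀ y → y ≢ 0# → ¬ IsSquare y → y ^ h ≡ - 1#
  euler-nonsquare y y≢0 ¬y□ with square-roots {y ^ h} {1#} y^h²≡1
    where
    y^h²≡1 : y ^ h * y ^ h ≡ 1# * 1#
    y^h²≡1 = trans (sym (x^2h≡x^h*x^h y)) (trans (cong (y ^_) (sym ∣nonzeros∣≡2h))
               (trans (x^∣nonzeros∣≡1 y y≢0) (sym (*-identityˡ 1#))))
  ... | inj₂ y^h≡-1 = y^h≡-1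
  ... | inj₁ y^h≡1  = ⊥-elim (ℕP.<⇒≱ (ℕP.n<1+n h) (∣roots[X^k-X^j]∣≤k 0<h (y ∷ squares) roots! roots))
    where
    0<h : 0 < h
    0<h with squares | ∈-squares 1≢0 (subst IsSquare (*-identityˡ 1#) (square-isSquare 1#))
    ... | _ ∷ _ | _ = s≤s z≤n
    roots! : Unique (y ∷ squares)
    roots! = All.tabulate (λ x∈ y≡x → ¬y□ (subst IsSquare (sym y≡x) (proj₂ (squares-spec x∈)))) AllPairs.∷ squares!
    roots : All (λ r → r ^ h ≡ r ^ 0) (y ∷ squares)
    roots = y^h≡1 ∷ All.tabulate (λ x∈ → euler-square _ (proj₁ (squares-spec x∈)) (proj₂ (squares-spec x∈)))

module AdditiveCharacter {c ℓ : Level} (F : FiniteField) (p : ℕ) (p-prime : Prime p) (E : ℕ)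
    (size≡p^E : FiniteField.size F ≡ p ℕ.^ E)
    (R : CommutativeRing c ℓ) (ζ : CommutativeRing.Carrier R)
    (geomSum≡0 : CommutativeRing._≈_ R (Characters.geomSum R F ζ p) (CommutativeRing.0# R)) where
  module 𝔽 = Field F
  open 𝔽 using (Carrier; _+_; _*_; -_; 0#; 1#; _⁻¹; _≟_; elements; unique; complete; fromℕ; solve; _:=_; _:+_; _:-_)
  open PrimeCharacteristic F p p-prime E size≡p^E
    using (p≢0; Tr; Trℕ; Trℕ-spec; Trℕ-cong; Trℕ-+; Tr-+; Tr-scale; fromℕ^p≡fromℕ; fromℕ-injective; ∃[Tr≡1])
  open CommutativeRing R renaming
    (Carrier to Rc; _+_ to _+ᴿ_; _*_ to _*ᴿ_; -_ to -ᴿ_; 0# to 0ᴿ; 1# to 1ᴿ)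
  open RingSums R
  open Characters R F using (_^ᴿ_; χ; ΣF; geomSum)
  open import Relation.Binary.Reasoning.Setoid setoid

  ^ᴿ-homo-* : ∀ x m n → x ^ᴿ (m ℕ.+ n) ≈ x ^ᴿ m *ᴿ x ^ᴿ n
  ^ᴿ-homo-* x zero    n = sym (*-identityˡ _)
  ^ᴿ-homo-* x (suc m) n = trans (*-congˡ (^ᴿ-homo-* x m n)) (sym (*-assoc _ _ _))

  ζ^p≈1 : ζ ^ᴿ p ≈ 1ᴿ
  ζ^p≈1 = begin
    ζ ^ᴿ p                          ≈⟨ +-identityˡ _ ⟨
    0ᴿ +ᴿ ζ ^ᴿ p                    ≈⟨ +-congʳ G≈0 ⟨
    ∑< p (ζ ^ᴿ_) +ᴿ ζ ^ᴿ p          ≈⟨ ∑<-snoc p (ζ ^ᴿ_) ⟨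
    1ᴿ +ᴿ ∑< p (λ k → ζ *ᴿ ζ ^ᴿ k)  ≈⟨ +-congˡ (∑<-distribˡ ζ p (ζ ^ᴿ_)) ⟩
    1ᴿ +ᴿ ζ *ᴿ ∑< p (ζ ^ᴿ_)         ≈⟨ +-congˡ (trans (*-congˡ G≈0) (zeroʳ ζ)) ⟩
    1ᴿ +ᴿ 0ᴿ                        ≈⟨ +-identityʳ _ ⟩
    1ᴿ                              ∎
    where
    G≈0 : ∑< p (ζ ^ᴿ_) ≈ 0ᴿ
    G≈0 = trans (reflexive (≡.sym (foldr-applyUpTo (ζ ^ᴿ_) id p))) geomSum≡0

  ζ^-%p : ∀ a → ζ ^ᴿ a ≈ ζ ^ᴿ (a % p)
  ζ^-%p a = begin
    ζ ^ᴿ a                                ≡⟨ cong (ζ ^ᴿ_) (m≡m%n+[m/n]*n a p) ⟩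
    ζ ^ᴿ (a % p ℕ.+ (a / p) ℕ.* p)        ≈⟨ ^ᴿ-homo-* ζ (a % p) _ ⟩
    ζ ^ᴿ (a % p) *ᴿ ζ ^ᴿ ((a / p) ℕ.* p)  ≈⟨ *-congˡ (ζ^[np]≈1 (a / p)) ⟩
    ζ ^ᴿ (a % p) *ᴿ 1ᴿ                    ≈⟨ *-identityʳ _ ⟩
    ζ ^ᴿ (a % p)                          ∎
    where
    ζ^[np]≈1 : ∀ n → ζ ^ᴿ (n ℕ.* p) ≈ 1ᴿ
    ζ^[np]≈1 zero    = refl
    ζ^[np]≈1 (suc n) = trans (^ᴿ-homo-* ζ p (n ℕ.* p)) (trans (*-cong ζ^p≈1 (ζ^[np]≈1 n)) (*-identityˡ _))

  ψ : Carrier → Rc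
  ψ = χ p E ζ

  ψ-+ : ∀ x y → ψ (x + y) ≈ ψ x *ᴿ ψ y
  ψ-+ x y = begin
    ζ ^ᴿ Trℕ (x + y)              ≡⟨ cong (ζ ^ᴿ_) (Trℕ-+ x y) ⟩
    ζ ^ᴿ ((Trℕ x ℕ.+ Trℕ y) % p)  ≈⟨ ζ^-%p _ ⟨
    ζ ^ᴿ (Trℕ x ℕ.+ Trℕ y)        ≈⟨ ^ᴿ-homo-* ζ (Trℕ x) (Trℕ y) ⟩
    ζ ^ᴿ Trℕ x *ᴿ ζ ^ᴿ Trℕ y      ∎

  ψ-cong-Tr : ∀ {x y} → Tr x ≡ Tr y → ψ x ≡ ψ y
  ψ-cong-Tr Trx≡Try = cong (ζ ^ᴿ_) (Trℕ-cong Trx≡Try)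

  #Tr⁻¹ : Carrier → Rc
  #Tr⁻¹ c = ∑ (λ x → indicator (Tr x ≟ c) 1ᴿ) elements

  -- Translation by an element of trace k maps the elements of trace 0 onto those of trace k.
  #Tr⁻¹[k]≈#Tr⁻¹[0] : ∀ k → #Tr⁻¹ (fromℕ k) ≈ #Tr⁻¹ 0#
  #Tr⁻¹[k]≈#Tr⁻¹[0] k = begin
    ∑ (λ x → indicator (Tr x ≟ fromℕ k) 1ᴿ) elements
      ≈⟨ ∑-reindex (λ x → indicator (Tr x ≟ fromℕ k) 1ᴿ) (_+ t) (λ x → x + - t) unique (λ _ → complete _) (λ _ → complete _)
           (λ x → solve 2 (λ x t → (x :+ t) :- t := x) ≡.refl x t) (λ x → solve 2 (λ x t → (x :- t) :+ t := x) ≡.refl x t) ⟨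
    ∑ (λ x → indicator (Tr (x + t) ≟ fromℕ k) 1ᴿ) elements
      ≈⟨ ∑-cong elements (λ x → indicator-⇔ (Tr (x + t) ≟ fromℕ k) (Tr x ≟ 0#) 1ᴿ
           (λ Tr≡k → 𝔽.+-cancelʳ (fromℕ k) _ _ (≡.trans (≡.sym (Tr[x+t] x)) (≡.trans Tr≡k (≡.sym (𝔽.+-identityˡ _)))))
           (λ Tr≡0 → ≡.trans (Tr[x+t] x) (≡.trans (cong (_+ fromℕ k) Tr≡0) (𝔽.+-identityˡ _)))) ⟩
    ∑ (λ x → indicator (Tr x ≟ 0#) 1ᴿ) elements ∎
    where
    a = proj₁ ∃[Tr≡1]
    t = fromℕ k * a
    Tr[x+t] : ∀ x → Tr (x + t) ≡ Tr x + fromℕ k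
    Tr[x+t] x = ≡.trans (Tr-+ x t) (cong (Tr x +_) (≡.trans (Tr-scale (fromℕ k) a (fromℕ^p≡fromℕ k))
                  (≡.trans (cong (fromℕ k *_) (proj₂ ∃[Tr≡1])) (𝔽.*-identityʳ _))))

  ∑ψ-Trℕ≡k : ∀ k → k < p → ∑ (λ x → indicator (Trℕ x ℕ.≟ k) (ψ x)) elements ≈ #Tr⁻¹ 0# *ᴿ ζ ^ᴿ k
  ∑ψ-Trℕ≡k k k<p = begin
    ∑ (λ x → indicator (Trℕ x ℕ.≟ k) (ψ x)) elements
      ≈⟨ ∑-cong elements (λ x → indicator-cong (Trℕ x ℕ.≟ k) (λ Trℕx≡k → reflexive (cong (ζ ^ᴿ_) Trℕx≡k))) ⟩
    ∑ (λ x → indicator (Trℕ x ℕ.≟ k) (ζ ^ᴿ k)) elements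
      ≈⟨ ∑-cong elements (λ x → indicator-⇔ (Trℕ x ℕ.≟ k) (Tr x ≟ fromℕ k) (ζ ^ᴿ k)
           (λ Trℕx≡k → ≡.trans (≡.sym (proj₂ (Trℕ-spec x))) (cong fromℕ Trℕx≡k))
           (λ Trx≡k → fromℕ-injective (proj₁ (Trℕ-spec x)) k<p (≡.trans (proj₂ (Trℕ-spec x)) Trx≡k))) ⟩
    ∑ (λ x → indicator (Tr x ≟ fromℕ k) (ζ ^ᴿ k)) elements
      ≈⟨ ∑-cong elements (λ x → indicator-* (Tr x ≟ fromℕ k) (ζ ^ᴿ k)) ⟩
    ∑ (λ x → indicator (Tr x ≟ fromℕ k) 1ᴿ *ᴿ ζ ^ᴿ k) elements
      ≈⟨ ∑-distribʳ (λ x → indicator (Tr x ≟ fromℕ k) 1ᴿ) (ζ ^ᴿ k) elements ⟩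
    #Tr⁻¹ (fromℕ k) *ᴿ ζ ^ᴿ k
      ≈⟨ *-congʳ (#Tr⁻¹[k]≈#Tr⁻¹[0] k) ⟩
    #Tr⁻¹ 0# *ᴿ ζ ^ᴿ k ∎

  ∑ψ≈0 : ΣF ψ ≈ 0ᴿ
  ∑ψ≈0 = begin
    ∑ ψ elements
      ≈⟨ ∑-fibres ℕ._≟_ Trℕ ψ elements (upTo p) (Unique.upTo⁺ p) (λ x _ → ∈-upTo⁺ (proj₁ (Trℕ-spec x))) ⟩
    ∑ (λ k → ∑ (λ x → indicator (Trℕ x ℕ.≟ k) (ψ x)) elements) (upTo p)
      ≈⟨ ∑-cong-∈ (upTo p) (λ k k∈ → ∑ψ-Trℕ≡k k (∈-upTo⁻ k∈)) ⟩
    ∑ (λ k → #Tr⁻¹ 0# *ᴿ ζ ^ᴿ k) (upTo p)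
      ≈⟨ ∑-distribˡ (#Tr⁻¹ 0#) (ζ ^ᴿ_) (upTo p) ⟩
    #Tr⁻¹ 0# *ᴿ geomSum ζ p
      ≈⟨ *-congˡ geomSum≡0 ⟩
    #Tr⁻¹ 0# *ᴿ 0ᴿ
      ≈⟨ zeroʳ _ ⟩
    0ᴿ ∎

  ∑ψ[A*]≈0 : ∀ A → A ≢ 0# → ΣF (λ x → ψ (A * x)) ≈ 0ᴿ
  ∑ψ[A*]≈0 A A≢0 = trans (∑-reindex ψ (A *_) (A ⁻¹ *_) unique (λ _ → complete _) (λ _ → complete _)
      (𝔽.inverse-cancel (𝔽.inverseˡ A A≢0)) (𝔽.inverse-cancel (𝔽.inverseʳ A A≢0))) ∑ψ≈0

module QuadraticCharacter {c ℓ : Level} (F : FiniteField) (p : ℕ) (p-prime : Prime p) (E : ℕ)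
    (size≡p^E : FiniteField.size F ≡ p ℕ.^ E)
    (R : CommutativeRing c ℓ) (ζ : CommutativeRing.Carrier R)
    (geomSum≡0 : CommutativeRing._≈_ R (Characters.geomSum R F ζ p) (CommutativeRing.0# R))
    (2<p : 2 < p) where
  module 𝔽 = Field F
  open 𝔽 using (Carrier; _*_; 0#; 1#; _⁻¹; _^_; _≟_; elements; unique; complete)
  open Squares F (PrimeCharacteristic.fromℕ-nonzero F p p-prime E size≡p^E (s≤s z≤n) 2<p)
  open AdditiveCharacter F p p-prime E size≡p^E R ζ geomSum≡0 using (ψ)
  open CommutativeRing R renaming
    (Carrier to Rc; _+_ to _+ᴿ_; _*_ to _*ᴿ_; -_ to -ᴿ_; 0# to 0ᴿ; 1# to 1ᴿ)
  open RingSums R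
  open Signs R renaming (fromSign to fromSignᴿ; fromSign-* to fromSignᴿ-*)
  open Characters R F using (η; ΣF; gauss)
  open import Relation.Binary.Reasoning.Setoid setoid

  η-0 : η 0# ≡ 0ᴿ
  η-0 with 0# ≟ 0#
  ... | yes _   = ≡.refl
  ... | no 0≢0 = ⊥-elim (0≢0 ≡.refl)

  η-square : ∀ {y} → y ≢ 0# → IsSquare y → η y ≡ 1ᴿ
  η-square {y} y≢0 y□ with y ≟ 0#
  ... | yes y≡0 = ⊥-elim (y≢0 y≡0)
  ... | no _ with isSquare? y
  ...   | yes _  = ≡.refl
  ...   | no ¬y□ = ⊥-elim (¬y□ y□)

  η-nonsquare : ∀ {y} → y ≢ 0# → ¬ IsSquare y → η y ≡ -ᴿ 1ᴿ
  η-nonsquare {y} y≢0 ¬y□ with y ≟ 0#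
  ... | yes y≡0 = ⊥-elim (y≢0 y≡0)
  ... | no _ with isSquare? y
  ...   | yes y□ = ⊥-elim (¬y□ y□)
  ...   | no _   = ≡.refl

  η≡y^h : ∀ {y} → y ≢ 0# → ∃ λ s → y ^ h ≡ 𝔽.fromSign s × η y ≡ fromSignᴿ s
  η≡y^h {y} y≢0 with isSquare? y
  ... | yes y□ = Sign.+ , euler-square y y≢0 y□ , η-square y≢0 y□
  ... | no ¬y□ = Sign.- , euler-nonsquare y y≢0 ¬y□ , η-nonsquare y≢0 ¬y□

  fromSign-injective : ∀ s t → 𝔽.fromSign s ≡ 𝔽.fromSign t → s ≡ t
  fromSign-injective Sign.+ Sign.+ _   = ≡.refl
  fromSign-injective Sign.+ Sign.- 1≡-1 = ⊥-elim (1≢-1 1≡-1)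
  fromSign-injective Sign.- Sign.+ -1≡1 = ⊥-elim (1≢-1 (≡.sym -1≡1))
  fromSign-injective Sign.- Sign.- _   = ≡.refl

  η-* : ∀ x y → η (x * y) ≈ η x *ᴿ η y
  η-* x y = by-cases (x ≟ 0#) (y ≟ 0#)
    where
    by-cases : Dec (x ≡ 0#) → Dec (y ≡ 0#) → η (x * y) ≈ η x *ᴿ η y
    by-cases (yes ≡.refl) _ = trans (reflexive (≡.trans (cong η (𝔽.zeroˡ y)) η-0))
                                    (sym (trans (*-congʳ (reflexive η-0)) (zeroˡ _)))
    by-cases (no _) (yes ≡.refl) = trans (reflexive (≡.trans (cong η (𝔽.zeroʳ x)) η-0))
                                         (sym (trans (*-congˡ (reflexive η-0)) (zeroʳ _)))
    by-cases (no x≢0) (no y≢0) =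
      let (s , x^h≡s , ηx≡s) = η≡y^h x≢0
          (t , y^h≡t , ηy≡t) = η≡y^h y≢0
          (u , xy^h≡u , ηxy≡u) = η≡y^h (𝔽.*-nonzero x≢0 y≢0)
          u≡st : u ≡ s Sign.* t
          u≡st = fromSign-injective u (s Sign.* t) (≡.trans (≡.sym xy^h≡u) (≡.trans (𝔽.^-distrib-* x y h)
                   (≡.trans (cong₂ _*_ x^h≡s y^h≡t) (≡.sym (𝔽.fromSign-* s t)))))
      in begin
        η (x * y)                   ≡⟨ ≡.trans ηxy≡u (cong fromSignᴿ u≡st) ⟩
        fromSignᴿ (s Sign.* t)      ≈⟨ fromSignᴿ-* s t ⟩
        fromSignᴿ s *ᴿ fromSignᴿ t  ≡⟨ cong₂ _*ᴿ_ ηx≡s ηy≡t ⟨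
        η x *ᴿ η y                  ∎

  η-⁻¹ : ∀ A → A ≢ 0# → η (A ⁻¹) ≈ η A
  η-⁻¹ A A≢0 = begin
    η (A ⁻¹)                ≡⟨ cong η (≡.sym (𝔽.inverse-cancel (𝔽.inverseʳ A A≢0) (A ⁻¹))) ⟩
    η (A * (A ⁻¹ * A ⁻¹))   ≈⟨ η-* A _ ⟩
    η A *ᴿ η (A ⁻¹ * A ⁻¹)  ≡⟨ cong (η A *ᴿ_) (η-square (𝔽.*-nonzero A⁻¹≢0 A⁻¹≢0) (square-isSquare (A ⁻¹))) ⟩
    η A *ᴿ 1ᴿ               ≈⟨ *-identityʳ _ ⟩
    η A                     ∎
    where A⁻¹≢0 = 𝔽.⁻¹-nonzero A A≢0

  gauss-twist : ∀ A → A ≢ 0# → ΣF (λ x → η x *ᴿ ψ (A * x)) ≈ η A *ᴿ gauss p E ζ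
  gauss-twist A A≢0 = begin
    ∑ (λ x → η x *ᴿ ψ (A * x)) elements
      ≈⟨ ∑-cong elements (λ x → *-congʳ (reflexive (cong η (≡.sym (𝔽.inverse-cancel (𝔽.inverseˡ A A≢0) x))))) ⟩
    ∑ (g ∘ (A *_)) elements
      ≈⟨ ∑-reindex g (A *_) (A ⁻¹ *_) unique (λ _ → complete _) (λ _ → complete _)
           (𝔽.inverse-cancel (𝔽.inverseˡ A A≢0)) (𝔽.inverse-cancel (𝔽.inverseʳ A A≢0)) ⟩
    ∑ g elements
      ≈⟨ ∑-cong elements (λ x → trans (*-congʳ (η-* (A ⁻¹) x)) (*-assoc _ _ _)) ⟩
    ∑ (λ x → η (A ⁻¹) *ᴿ (η x *ᴿ ψ x)) elements
      ≈⟨ ∑-distribˡ (η (A ⁻¹)) (λ x → η x *ᴿ ψ x) elements ⟩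
    η (A ⁻¹) *ᴿ gauss p E ζ
      ≈⟨ *-congʳ (η-⁻¹ A A≢0) ⟩
    η A *ᴿ gauss p E ζ ∎
    where
    g : Carrier → Rc
    g x = η (A ⁻¹ * x) *ᴿ ψ x

q+1∣q^[1+2k]+1 : ∀ q k → suc q ∣ q ℕ.^ suc (2 ℕ.* k) ℕ.+ 1
q+1∣q^[1+2k]+1 q zero = divides 1 (identity q)
  where
  identity : ∀ q → q ℕ.* 1 ℕ.+ 1 ≡ 1 ℕ.* suc q
  identity = solve-∀
q+1∣q^[1+2k]+1 zero (suc k) = divides 1 ≡.refl
q+1∣q^[1+2k]+1 (suc a) (suc k) = ∣m+n∣m⇒∣n (subst (suc (suc a) ∣_) identity (∣n⇒∣m*n (suc a ℕ.* suc a) (q+1∣q^[1+2k]+1 (suc a) k))) (n∣m*n a)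
  where
  -- q²(q^(2k+1) + 1) = (q^(2k+3) + 1) + (q - 1)(q + 1), with q = a + 1.
  identity : suc a ℕ.* suc a ℕ.* (suc a ℕ.^ suc (2 ℕ.* k) ℕ.+ 1) ≡ a ℕ.* suc (suc a) ℕ.+ (suc a ℕ.^ suc (2 ℕ.* suc k) ℕ.+ 1)
  identity = ≡.trans (lemma a (suc a ℕ.^ suc (2 ℕ.* k)))
    (cong (λ z → a ℕ.* suc (suc a) ℕ.+ (z ℕ.+ 1))
      (≡.sym (≡.trans (cong (λ z → suc a ℕ.^ suc z) (ℕP.*-suc 2 k)) (≡.sym (ℕP.*-assoc (suc a) (suc a) _)))))
    where
    lemma : ∀ a x → suc a ℕ.* suc a ℕ.* (x ℕ.+ 1) ≡ a ℕ.* suc (suc a) ℕ.+ (suc a ℕ.* suc a ℕ.* x ℕ.+ 1)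
    lemma = solve-∀

module QPlusOnePower (F : FiniteField) (p : ℕ) (p-prime : Prime p) (E : ℕ)
    (size≡p^E : FiniteField.size F ≡ p ℕ.^ E) (2<p : 2 < p)
    (m q : ℕ) (q≡p^m : q ≡ p ℕ.^ m) (n k : ℕ) (n≡1+2k : n ≡ suc (2 ℕ.* k))
    (size≡q^n : FiniteField.size F ≡ q ℕ.^ n) (r : ℕ) (q+1≡2r : q ℕ.+ 1 ≡ 2 ℕ.* r) where
  open Field F
  open ≡ using (refl; sym; trans)
  open ≡.≡-Reasoning
  open PrimeCharacteristic F p p-prime E size≡p^E
  open Squares F (fromℕ-nonzero (s≤s z≤n) 2<p)

  0<q : 0 < q
  0<q = subst (0 <_) (sym q≡p^m) (ℕ.>-nonZero⁻¹ (p ℕ.^ m) {{ℕP.m^n≢0 p m}})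

  frobenius-q : ∀ x y → (x + y) ^ q ≡ x ^ q + y ^ q
  frobenius-q x y = subst (λ q → (x + y) ^ q ≡ x ^ q + y ^ q) (sym q≡p^m) (frobenius-^ m x y)

  -‿^q : ∀ x → (- x) ^ q ≡ - (x ^ q)
  -‿^q x = begin
    (- x) ^ q                    ≡⟨ solve 2 (λ a b → b := (a :+ b) :- a) refl (x ^ q) ((- x) ^ q) ⟩
    (x ^ q + (- x) ^ q) - x ^ q  ≡⟨ cong (_- x ^ q) (sym (frobenius-q x (- x))) ⟩
    (x + - x) ^ q - x ^ q        ≡⟨ cong (λ z → z ^ q - x ^ q) (-‿inverseʳ x) ⟩
    0# ^ q - x ^ q               ≡⟨ cong (_- x ^ q) (0^n≡0 0<q) ⟩
    0# - x ^ q                   ≡⟨ +-identityˡ _ ⟩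
    - (x ^ q)                    ∎

  fromℕ^q≡fromℕ : ∀ j → fromℕ j ^ q ≡ fromℕ j
  fromℕ^q≡fromℕ j = subst (λ q → fromℕ j ^ q ≡ fromℕ j) (sym q≡p^m) (^-fixed-^ (fromℕ^p≡fromℕ j) m)

  x^q^n≡x : ∀ x → x ^ (q ℕ.^ n) ≡ x
  x^q^n≡x x = trans (cong (x ^_) (sym size≡q^n)) (x^size≡x x)

  Tr-^q : ∀ y → Tr (y ^ q) ≡ Tr y
  Tr-^q y = subst (λ q → Tr (y ^ q) ≡ Tr y) (sym q≡p^m) (Tr-^p^i m y)

  ^[q+1]≡^q* : ∀ z → z ^ (q ℕ.+ 1) ≡ z ^ q * z
  ^[q+1]≡^q* z = trans (^-homo-* z q 1) (cong (z ^ q *_) (x^1≡x z))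

  -- If z^(q+1) = 1 then z^q = z⁻¹, so z^(q²) = z; as n is odd, z^q = z^(q^n) = z and z² = 1.
  ^[q+1]≡1⇒≡±1 : ∀ z → z ^ (q ℕ.+ 1) ≡ 1# → z ≡ 1# ⊎ z ≡ - 1#
  ^[q+1]≡1⇒≡±1 z z^[q+1]≡1 = square-roots (trans (cong (_* z) (sym z^q≡z)) (trans (sym (^[q+1]≡^q* z)) (trans z^[q+1]≡1 (sym (*-identityˡ 1#)))))
    where
    y = z ^ q
    yz≡1 : y * z ≡ 1#
    yz≡1 = trans (sym (^[q+1]≡^q* z)) z^[q+1]≡1
    y≢0 : y ≢ 0#
    y≢0 y≡0 = 1≢0 (trans (sym yz≡1) (trans (cong (_* z) y≡0) (zeroˡ z)))
    y^q≡z : y ^ q ≡ z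
    y^q≡z = *-cancelˡ y y≢0 (begin
      y * y ^ q      ≡⟨ *-comm _ _ ⟩
      y ^ q * z ^ q  ≡⟨ sym (^-distrib-* y z q) ⟩
      (y * z) ^ q    ≡⟨ cong (_^ q) yz≡1 ⟩
      1# ^ q         ≡⟨ 1^n≡1 q ⟩
      1#             ≡⟨ sym yz≡1 ⟩
      y * z          ∎)
    z^q^[2j]≡z : ∀ j → z ^ (q ℕ.^ (2 ℕ.* j)) ≡ z
    z^q^[2j]≡z zero    = x^1≡x z
    z^q^[2j]≡z (suc j) = begin
      z ^ (q ℕ.^ (2 ℕ.* suc j))            ≡⟨ cong (λ t → z ^ (q ℕ.^ t)) (ℕP.*-suc 2 j) ⟩
      z ^ (q ℕ.* (q ℕ.* q ℕ.^ (2 ℕ.* j)))  ≡⟨ sym (^-assocʳ z q _) ⟩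
      y ^ (q ℕ.* q ℕ.^ (2 ℕ.* j))          ≡⟨ sym (^-assocʳ y q _) ⟩
      (y ^ q) ^ (q ℕ.^ (2 ℕ.* j))          ≡⟨ cong (_^ (q ℕ.^ (2 ℕ.* j))) y^q≡z ⟩
      z ^ (q ℕ.^ (2 ℕ.* j))                ≡⟨ z^q^[2j]≡z j ⟩
      z                                    ∎
    z^q≡z : y ≡ z
    z^q≡z = begin
      z ^ q                        ≡⟨ cong (_^ q) (sym (z^q^[2j]≡z k)) ⟩
      (z ^ (q ℕ.^ (2 ℕ.* k))) ^ q  ≡⟨ ^-assocʳ z (q ℕ.^ (2 ℕ.* k)) q ⟩
      z ^ (q ℕ.^ (2 ℕ.* k) ℕ.* q)  ≡⟨ cong (z ^_) (ℕP.*-comm (q ℕ.^ (2 ℕ.* k)) q) ⟩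
      z ^ (q ℕ.^ suc (2 ℕ.* k))    ≡⟨ cong (λ t → z ^ (q ℕ.^ t)) (sym n≡1+2k) ⟩
      z ^ (q ℕ.^ n)                ≡⟨ x^q^n≡x z ⟩
      z                            ∎

  ^[q+1]≡square : ∀ w → w ^ (q ℕ.+ 1) ≡ w ^ r * w ^ r
  ^[q+1]≡square w = trans (cong (w ^_) (trans q+1≡2r (cong (r ℕ.+_) (ℕP.+-identityʳ r)))) (^-homo-* w r r)

  -‿^[q+1] : ∀ v → (- v) ^ (q ℕ.+ 1) ≡ v ^ (q ℕ.+ 1)
  -‿^[q+1] v = trans (cong ((- v) ^_) q+1≡2r) (trans (-‿^-even v r) (cong (v ^_) (sym q+1≡2r)))

  ^[q+1]-injective-up-to-sign : ∀ {w v} → v ≢ 0# → w ^ (q ℕ.+ 1) ≡ v ^ (q ℕ.+ 1) → w ≡ v ⊎ w ≡ - v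
  ^[q+1]-injective-up-to-sign {w} {v} v≢0 w^[q+1]≡v^[q+1] with ^[q+1]≡1⇒≡±1 (w * v ⁻¹) ratio^[q+1]≡1
    where
    ratio^[q+1]≡1 : (w * v ⁻¹) ^ (q ℕ.+ 1) ≡ 1#
    ratio^[q+1]≡1 = begin
      (w * v ⁻¹) ^ (q ℕ.+ 1)              ≡⟨ ^-distrib-* w (v ⁻¹) (q ℕ.+ 1) ⟩
      w ^ (q ℕ.+ 1) * (v ⁻¹) ^ (q ℕ.+ 1)  ≡⟨ cong (_* (v ⁻¹) ^ (q ℕ.+ 1)) w^[q+1]≡v^[q+1] ⟩
      v ^ (q ℕ.+ 1) * (v ⁻¹) ^ (q ℕ.+ 1)  ≡⟨ sym (^-distrib-* v (v ⁻¹) (q ℕ.+ 1)) ⟩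
      (v * v ⁻¹) ^ (q ℕ.+ 1)              ≡⟨ cong (_^ (q ℕ.+ 1)) (inverseʳ v v≢0) ⟩
      1# ^ (q ℕ.+ 1)                      ≡⟨ 1^n≡1 (q ℕ.+ 1) ⟩
      1#                                  ∎
  ... | inj₁ ratio≡1  = inj₁ (trans w≡ratio*v (trans (cong (_* v) ratio≡1) (*-identityˡ v)))
    where w≡ratio*v = sym (trans (*-assoc _ _ _) (trans (cong (w *_) (inverseˡ v v≢0)) (*-identityʳ w)))
  ... | inj₂ ratio≡-1 = inj₂ (trans w≡ratio*v (trans (cong (_* v) ratio≡-1) (solve 1 (λ v → (:- con (pos 1)) :* v := :- v) refl v)))
    where w≡ratio*v = sym (trans (*-assoc _ _ _) (trans (cong (w *_) (inverseˡ v v≢0)) (*-identityʳ w)))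

  -- a² = (a^u)^(q+1) where u (q + 1) = q^n + 1.
  square⇒^[q+1] : ∀ c → c ≢ 0# → IsSquare c → ∃ λ v → v ≢ 0# × v ^ (q ℕ.+ 1) ≡ c
  square⇒^[q+1] c c≢0 c□ with squareRoot c□ | q+1∣q^n+1
    where
    q+1∣q^n+1 : q ℕ.+ 1 ∣ q ℕ.^ n ℕ.+ 1
    q+1∣q^n+1 = subst₂ (λ a b → a ∣ b ℕ.^ n ℕ.+ 1) (ℕP.+-comm 1 q) refl
                  (subst (λ t → suc q ∣ q ℕ.^ t ℕ.+ 1) (sym n≡1+2k) (q+1∣q^[1+2k]+1 q k))
  ... | a , refl | divides u q^n+1≡u[q+1] = a ^ u , ^-nonzero a u a≢0 , (begin
    (a ^ u) ^ (q ℕ.+ 1)    ≡⟨ ^-assocʳ a u (q ℕ.+ 1) ⟩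
    a ^ (u ℕ.* (q ℕ.+ 1))  ≡⟨ cong (a ^_) (sym q^n+1≡u[q+1]) ⟩
    a ^ (q ℕ.^ n ℕ.+ 1)    ≡⟨ ^-homo-* a (q ℕ.^ n) 1 ⟩
    a ^ (q ℕ.^ n) * a ^ 1  ≡⟨ cong₂ _*_ (x^q^n≡x a) (x^1≡x a) ⟩
    a * a                  ∎)
    where
    a≢0 : a ≢ 0#
    a≢0 a≡0 = c≢0 (trans (cong (_* a) a≡0) (zeroˡ a))

oddExp : ℕ → ℕ → ℕ
oddExp q zero    = 0
oddExp q (suc j) = q ℕ.^ suc (2 ℕ.* j) ℕ.+ oddExp q j

-- The norm of A from F_{q^n} to F_q is A ^ normExp q n.
normExp : ℕ → ℕ → ℕ
normExp q n = ℕSum.∑< n (q ℕ.^_)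

module _ (q : ℕ) where

  normExp-odd-step : ∀ k → normExp q (suc (2 ℕ.* suc k)) ≡ normExp q (suc (2 ℕ.* k)) ℕ.+ q ℕ.^ suc (2 ℕ.* k) ℕ.+ q ℕ.* q ℕ.^ suc (2 ℕ.* k)
  normExp-odd-step k = ≡.trans (cong (λ t → normExp q (suc t)) (ℕP.*-suc 2 k))
    (≡.trans (ℕSum.∑<-snoc (suc (suc (2 ℕ.* k))) (q ℕ.^_))
             (cong (ℕ._+ q ℕ.^ suc (suc (2 ℕ.* k))) (ℕSum.∑<-snoc (suc (2 ℕ.* k)) (q ℕ.^_))))

  1+oddExp*[q+1]≡normExp : ∀ k → 1 ℕ.+ oddExp q k ℕ.* (q ℕ.+ 1) ≡ normExp q (suc (2 ℕ.* k))
  1+oddExp*[q+1]≡normExp zero    = ≡.refl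
  1+oddExp*[q+1]≡normExp (suc k) = ≡.trans (identity (q ℕ.^ suc (2 ℕ.* k)) (oddExp q k) q)
    (≡.trans (cong (λ z → z ℕ.+ q ℕ.^ suc (2 ℕ.* k) ℕ.+ q ℕ.* q ℕ.^ suc (2 ℕ.* k)) (1+oddExp*[q+1]≡normExp k))
             (≡.sym (normExp-odd-step k)))
    where
    identity : ∀ a t q → 1 ℕ.+ (a ℕ.+ t) ℕ.* (q ℕ.+ 1) ≡ (1 ℕ.+ t ℕ.* (q ℕ.+ 1)) ℕ.+ a ℕ.+ q ℕ.* a
    identity = solve-∀

  oddExp+1+sExp≡normExp : ∀ k → oddExp q k ℕ.+ 1 ℕ.+ sExp q k ≡ normExp q (suc (2 ℕ.* k))
  oddExp+1+sExp≡normExp zero    = ≡.refl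
  oddExp+1+sExp≡normExp (suc k) =
    ≡.trans (cong (λ z → oddExp q (suc k) ℕ.+ 1 ℕ.+ (q ℕ.^ z ℕ.+ sExp q k)) (ℕP.*-suc 2 k))
    (≡.trans (identity (q ℕ.^ suc (2 ℕ.* k)) (oddExp q k) (sExp q k) q)
    (≡.trans (cong (λ z → z ℕ.+ q ℕ.^ suc (2 ℕ.* k) ℕ.+ q ℕ.* q ℕ.^ suc (2 ℕ.* k)) (oddExp+1+sExp≡normExp k))
             (≡.sym (normExp-odd-step k))))
    where
    identity : ∀ a t s q → (a ℕ.+ t) ℕ.+ 1 ℕ.+ (q ℕ.* a ℕ.+ s) ≡ (t ℕ.+ 1 ℕ.+ s) ℕ.+ a ℕ.+ q ℕ.* a
    identity = solve-∀

  q+oddExp*q²≡oddExp+q^[1+2k] : ∀ k → q ℕ.+ oddExp q k ℕ.* (q ℕ.* q) ≡ oddExp q k ℕ.+ q ℕ.^ suc (2 ℕ.* k)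
  q+oddExp*q²≡oddExp+q^[1+2k] zero    = ≡.trans (ℕP.+-identityʳ q) (≡.sym (ℕP.*-identityʳ q))
  q+oddExp*q²≡oddExp+q^[1+2k] (suc k) =
    ≡.trans (identity₁ a (oddExp q k) q)
    (≡.trans (cong (a ℕ.* (q ℕ.* q) ℕ.+_) (q+oddExp*q²≡oddExp+q^[1+2k] k))
    (≡.trans (identity₂ a (oddExp q k) q) (cong (λ z → oddExp q (suc k) ℕ.+ q ℕ.^ suc z) (≡.sym (ℕP.*-suc 2 k)))))
    where
    a = q ℕ.^ suc (2 ℕ.* k)
    identity₁ : ∀ a t q → q ℕ.+ (a ℕ.+ t) ℕ.* (q ℕ.* q) ≡ a ℕ.* (q ℕ.* q) ℕ.+ (q ℕ.+ t ℕ.* (q ℕ.* q))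
    identity₁ = solve-∀
    identity₂ : ∀ a t q → a ℕ.* (q ℕ.* q) ℕ.+ (t ℕ.+ a) ≡ (a ℕ.+ t) ℕ.+ q ℕ.* (q ℕ.* a)
    identity₂ = solve-∀

  normExp*q+1≡normExp+q^n : ∀ n → normExp q n ℕ.* q ℕ.+ 1 ≡ normExp q n ℕ.+ q ℕ.^ n
  normExp*q+1≡normExp+q^n zero    = ≡.refl
  normExp*q+1≡normExp+q^n (suc n) =
    ≡.trans (cong (λ z → z ℕ.* q ℕ.+ 1) (ℕSum.∑<-snoc n (q ℕ.^_)))
    (≡.trans (identity₁ (normExp q n) (q ℕ.^ n) q)
    (≡.trans (cong (ℕ._+ q ℕ.^ n ℕ.* q) (normExp*q+1≡normExp+q^n n))
    (≡.trans (identity₂ (normExp q n) (q ℕ.^ n) q) (cong (ℕ._+ q ℕ.^ suc n) (≡.sym (ℕSum.∑<-snoc n (q ℕ.^_)))))))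
    where
    identity₁ : ∀ s a q → (s ℕ.+ a) ℕ.* q ℕ.+ 1 ≡ (s ℕ.* q ℕ.+ 1) ℕ.+ a ℕ.* q
    identity₁ = solve-∀
    identity₂ : ∀ s a q → (s ℕ.+ a) ℕ.+ a ℕ.* q ≡ (s ℕ.+ a) ℕ.+ q ℕ.* a
    identity₂ = solve-∀

module CompletingTheSquare (F : FiniteField) (p : ℕ) (p-prime : Prime p) (E : ℕ)
    (size≡p^E : FiniteField.size F ≡ p ℕ.^ E) (2<p : 2 < p)
    (m q : ℕ) (q≡p^m : q ≡ p ℕ.^ m) (n k : ℕ) (n≡1+2k : n ≡ suc (2 ℕ.* k))
    (size≡q^n : FiniteField.size F ≡ q ℕ.^ n) (r : ℕ) (q+1≡2r : q ℕ.+ 1 ≡ 2 ℕ.* r) where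
  open Field F
  open ≡ using (refl; sym; trans)
  open ≡.≡-Reasoning
  open PrimeCharacteristic F p p-prime E size≡p^E using (Tr; Tr-+; fromℕ-nonzero)
  open QPlusOnePower F p p-prime E size≡p^E 2<p m q q≡p^m n k n≡1+2k size≡q^n r q+1≡2r

  φ : Carrier → Carrier
  φ x = x ^ q

  φ-* : ∀ x y → φ (x * y) ≡ φ x * φ y
  φ-* x y = ^-distrib-* x y q

  φ-^ : ∀ x a → φ (x ^ a) ≡ x ^ (a ℕ.* q)
  φ-^ x a = ^-assocʳ x a q

  φ-∑< : ∀ j g → φ (∑< j g) ≡ ∑< j (φ ∘ g)
  φ-∑< zero    g = 0^n≡0 0<q
  φ-∑< (suc j) g = trans (frobenius-q (g 0) _) (cong (φ (g 0) +_) (φ-∑< j (g ∘ suc)))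

  φ-sign : ∀ j → φ (sign j) ≡ sign j
  φ-sign zero    = 1^n≡1 q
  φ-sign (suc j) = trans (-‿^q (sign j)) (cong -_ (φ-sign j))

  sign-even : ∀ j → sign (2 ℕ.* j) ≡ 1#
  sign-even zero    = refl
  sign-even (suc j) = trans (cong sign (ℕP.*-suc 2 j)) (trans (-‿involutive _) (sign-even j))

  Π<≡^normExp : ∀ A → Π< n (λ i → A ^ (q ℕ.^ i)) ≡ A ^ normExp q n
  Π<≡^normExp A = trans (Product.foldr-applyUpTo (λ i → A ^ (q ℕ.^ i)) id n) (∏<-^ (q ℕ.^_) n)
    where
    ∏<-^ : ∀ f j → Product.∑< j (λ i → A ^ f i) ≡ A ^ ℕSum.∑< j f
    ∏<-^ f zero    = refl
    ∏<-^ f (suc j) = trans (cong (A ^ f 0 *_) (∏<-^ (f ∘ suc) j)) (sym (^-homo-* A (f 0) _))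

  module _ (x : Carrier) where
    private
      term : ℕ → Carrier
      term i = sign (suc i) * x ^ (q ℕ.^ (2 ℕ.* i))

      φ²-term : ∀ i → φ (φ (term i)) ≡ - term (suc i)
      φ²-term i = begin
        φ (φ (sign (suc i) * a))        ≡⟨ trans (cong φ (φ-* (sign (suc i)) a)) (φ-* _ _) ⟩
        φ (φ (sign (suc i))) * φ (φ a)  ≡⟨ cong₂ _*_ (trans (cong φ (φ-sign (suc i))) (φ-sign (suc i))) φ²a≡a′ ⟩
        sign (suc i) * a′               ≡⟨ cong (_* a′) (sym (-‿involutive (sign (suc i)))) ⟩
        - - sign (suc i) * a′           ≡⟨ sym (-‿distribˡ-* _ _) ⟩
        - term (suc i)                  ∎
        where
        a  = x ^ (q ℕ.^ (2 ℕ.* i))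
        a′ = x ^ (q ℕ.^ (2 ℕ.* suc i))
        φ²a≡a′ : φ (φ a) ≡ a′
        φ²a≡a′ = trans (cong φ (φ-^ x (q ℕ.^ (2 ℕ.* i)))) (trans (φ-^ x (q ℕ.^ (2 ℕ.* i) ℕ.* q))
          (cong (x ^_) (trans (exponent (q ℕ.^ (2 ℕ.* i)) q) (cong (q ℕ.^_) (sym (ℕP.*-suc 2 i))))))
          where
          exponent : ∀ b q → b ℕ.* q ℕ.* q ≡ q ℕ.* (q ℕ.* b)
          exponent = solve-∀

      term-0 : term 0 ≡ - x
      term-0 = solve 1 (λ x → (:- con (pos 1)) :* (x :* con (pos 1)) := :- x) refl x

      -- x^(q^(2n)) = x, and the sign is + because n is odd.
      term-n : term n ≡ x
      term-n = trans (cong₂ _*_ sign[1+n]≡1 x^q^[2n]≡x) (*-identityˡ x)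
        where
        sign[1+n]≡1 : sign (suc n) ≡ 1#
        sign[1+n]≡1 = trans (cong (sign ∘ suc) n≡1+2k) (trans (cong sign (sym (ℕP.*-suc 2 k))) (sign-even (suc k)))
        x^q^[2n]≡x : x ^ (q ℕ.^ (2 ℕ.* n)) ≡ x
        x^q^[2n]≡x = begin
          x ^ (q ℕ.^ (2 ℕ.* n))        ≡⟨ cong (λ t → x ^ (q ℕ.^ (n ℕ.+ t))) (ℕP.+-identityʳ n) ⟩
          x ^ (q ℕ.^ (n ℕ.+ n))        ≡⟨ cong (x ^_) (ℕP.^-distribˡ-+-* q n n) ⟩
          x ^ (q ℕ.^ n ℕ.* q ℕ.^ n)    ≡⟨ sym (^-assocʳ x (q ℕ.^ n) (q ℕ.^ n)) ⟩
          (x ^ (q ℕ.^ n)) ^ (q ℕ.^ n)  ≡⟨ trans (cong (_^ (q ℕ.^ n)) (x^q^n≡x x)) (x^q^n≡x x) ⟩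
          x                            ∎

      ∑<-term-shift : ∑< n (term ∘ suc) ≡ ∑< n term + x + x
      ∑<-term-shift = +-cancelˡ (term 0) _ _ (begin
        term 0 + ∑< n (term ∘ suc)    ≡⟨ ∑<-snoc n term ⟩
        ∑< n term + term n            ≡⟨ cong (∑< n term +_) term-n ⟩
        ∑< n term + x                 ≡⟨ solve 2 (λ L x → L :+ x := (:- x) :+ (L :+ x :+ x)) refl (∑< n term) x ⟩
        - x + (∑< n term + x + x)     ≡⟨ cong (_+ (∑< n term + x + x)) (sym term-0) ⟩
        term 0 + (∑< n term + x + x)  ∎)

    φ²-lam : φ (φ (lam q n x)) ≡ - (fromℕ 2 * x) - lam q n x
    φ²-lam = begin
      φ (φ (lam q n x))            ≡⟨ cong (φ ∘ φ) (foldr-applyUpTo term id n) ⟩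
      φ (φ (∑< n term))            ≡⟨ trans (cong φ (φ-∑< n term)) (φ-∑< n (φ ∘ term)) ⟩
      ∑< n (λ i → φ (φ (term i)))  ≡⟨ ∑<-cong n (λ i _ → φ²-term i) ⟩
      ∑< n (λ i → - term (suc i))  ≡⟨ ∑<-neg n (term ∘ suc) ⟩
      - ∑< n (term ∘ suc)          ≡⟨ cong -_ ∑<-term-shift ⟩
      - (∑< n term + x + x)        ≡⟨ solve 2 (λ L x → :- (L :+ x :+ x) := :- ((con (pos 1) :+ (con (pos 1) :+ con (pos 0))) :* x) :- L) refl (∑< n term) x ⟩
      - (fromℕ 2 * x) - ∑< n term  ≡⟨ cong (λ z → - (fromℕ 2 * x) - z) (sym (foldr-applyUpTo term id n)) ⟩
      - (fromℕ 2 * x) - lam q n x  ∎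

  module _ (A B : Carrier) (A≢0 : A ≢ 0#) where
    s t : ℕ
    s = sExp q k
    t = oddExp q k

    N : Carrier
    N = Π< n (λ i → A ^ (q ℕ.^ i))

    L : Carrier
    L = lam q n (A ^ s * B ^ q)

    X : Carrier
    X = - (L ^ (q ℕ.+ 1)) * ((fromℕ 4 * N) ⁻¹)

    private
      D : Carrier
      D = (fromℕ 2 * N) ⁻¹

      N≢0 : N ≢ 0#
      N≢0 N≡0 = ^-nonzero A (normExp q n) A≢0 (trans (sym (Π<≡^normExp A)) N≡0)

      2N≢0 : fromℕ 2 * N ≢ 0#
      2N≢0 = *-nonzero (fromℕ-nonzero (s≤s z≤n) 2<p) N≢0

      2ND≡1 : fromℕ 2 * N * D ≡ 1#
      2ND≡1 = inverseʳ _ 2N≢0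

      φN≡N : φ N ≡ N
      φN≡N = *-cancelˡ A A≢0 (begin
        A * φ N                          ≡⟨ cong (λ z → A * φ z) (Π<≡^normExp A) ⟩
        A * φ (A ^ normExp q n)          ≡⟨ cong (A *_) (φ-^ A (normExp q n)) ⟩
        A * A ^ (normExp q n ℕ.* q)      ≡⟨ trans (*-comm _ _) (cong (A ^ (normExp q n ℕ.* q) *_) (sym (x^1≡x A))) ⟩
        A ^ (normExp q n ℕ.* q) * A ^ 1  ≡⟨ sym (^-homo-* A (normExp q n ℕ.* q) 1) ⟩
        A ^ (normExp q n ℕ.* q ℕ.+ 1)    ≡⟨ cong (A ^_) (normExp*q+1≡normExp+q^n q n) ⟩
        A ^ (normExp q n ℕ.+ q ℕ.^ n)    ≡⟨ ^-homo-* A (normExp q n) (q ℕ.^ n) ⟩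
        A ^ normExp q n * A ^ (q ℕ.^ n)  ≡⟨ cong₂ _*_ (sym (Π<≡^normExp A)) (x^q^n≡x A) ⟩
        N * A                            ≡⟨ *-comm _ _ ⟩
        A * N                            ∎)

      φD≡D : φ D ≡ D
      φD≡D = ⁻¹-fixed-^ q 2N≢0 (trans (φ-* (fromℕ 2) N) (cong₂ _*_ (fromℕ^q≡fromℕ 2) φN≡N))

      A^[1+t[q+1]]≡N : A * (A ^ t) ^ (q ℕ.+ 1) ≡ N
      A^[1+t[q+1]]≡N = begin
        A * (A ^ t) ^ (q ℕ.+ 1)        ≡⟨ cong₂ _*_ (sym (x^1≡x A)) (^-assocʳ A t (q ℕ.+ 1)) ⟩
        A ^ 1 * A ^ (t ℕ.* (q ℕ.+ 1))  ≡⟨ sym (^-homo-* A 1 (t ℕ.* (q ℕ.+ 1))) ⟩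
        A ^ (1 ℕ.+ t ℕ.* (q ℕ.+ 1))    ≡⟨ cong (A ^_) (trans (1+oddExp*[q+1]≡normExp q k) (cong (normExp q) (sym n≡1+2k))) ⟩
        A ^ normExp q n                ≡⟨ sym (Π<≡^normExp A) ⟩
        N                              ∎

      A^[t+1+s]≡N : A ^ t * A * A ^ s ≡ N
      A^[t+1+s]≡N = begin
        A ^ t * A * A ^ s      ≡⟨ cong (λ z → A ^ t * z * A ^ s) (sym (x^1≡x A)) ⟩
        A ^ t * A ^ 1 * A ^ s  ≡⟨ cong (_* A ^ s) (sym (^-homo-* A t 1)) ⟩
        A ^ (t ℕ.+ 1) * A ^ s  ≡⟨ sym (^-homo-* A (t ℕ.+ 1) s) ⟩
        A ^ (t ℕ.+ 1 ℕ.+ s)    ≡⟨ cong (A ^_) (trans (oddExp+1+sExp≡normExp q k) (cong (normExp q) (sym n≡1+2k))) ⟩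
        A ^ normExp q n        ≡⟨ sym (Π<≡^normExp A) ⟩
        N                      ∎

      A^[q+tq²]≡A^[t+1] : A ^ q * φ (φ (A ^ t)) ≡ A ^ t * A
      A^[q+tq²]≡A^[t+1] = begin
        A ^ q * φ (φ (A ^ t))              ≡⟨ cong (A ^ q *_) (trans (cong φ (φ-^ A t)) (trans (φ-^ A (t ℕ.* q)) (cong (A ^_) (ℕP.*-assoc t q q)))) ⟩
        A ^ q * A ^ (t ℕ.* (q ℕ.* q))      ≡⟨ sym (^-homo-* A q _) ⟩
        A ^ (q ℕ.+ t ℕ.* (q ℕ.* q))        ≡⟨ cong (A ^_) (q+oddExp*q²≡oddExp+q^[1+2k] q k) ⟩
        A ^ (t ℕ.+ q ℕ.^ suc (2 ℕ.* k))    ≡⟨ ^-homo-* A t _ ⟩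
        A ^ t * A ^ (q ℕ.^ suc (2 ℕ.* k))  ≡⟨ cong (λ z → A ^ t * A ^ (q ℕ.^ z)) (sym n≡1+2k) ⟩
        A ^ t * A ^ (q ℕ.^ n)              ≡⟨ cong (A ^ t *_) (x^q^n≡x A) ⟩
        A ^ t * A                          ∎

    y : Carrier
    y = - (A ^ t * L * D)

    Ay+A^qφ²y≡B^q : A * y + A ^ q * φ (φ y) ≡ B ^ q
    Ay+A^qφ²y≡B^q = begin
      A * y + A ^ q * φ (φ y)
        ≡⟨ cong (λ z → A * y + A ^ q * z) (trans (cong φ (-‿^q _)) (-‿^q _)) ⟩
      A * - (T * L * D) + A ^ q * - φ (φ (T * L * D))
        ≡⟨ cong (λ z → A * - (T * L * D) + A ^ q * - z) φ²[TLD] ⟩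
      A * - (T * L * D) + A ^ q * - (φ (φ T) * φ (φ L) * D)
        ≡⟨ solve 7 (λ A T L D Aq T² L² → A :* (:- (T :* L :* D)) :+ Aq :* (:- (T² :* L² :* D))
                                       := :- (A :* T :* L :* D) :- (Aq :* T²) :* L² :* D) refl A T L D (A ^ q) (φ (φ T)) (φ (φ L)) ⟩
      - (A * T * L * D) - (A ^ q * φ (φ T)) * φ (φ L) * D
        ≡⟨ cong₂ (λ a b → - (A * T * L * D) - a * b * D) A^[q+tq²]≡A^[t+1] (φ²-lam (A ^ s * B ^ q)) ⟩
      - (A * T * L * D) - (T * A) * (- (fromℕ 2 * (A ^ s * B ^ q)) - L) * D
        ≡⟨ solve 7 (λ A T L D two As Bq → :- (A :* T :* L :* D) :- (T :* A) :* (:- (two :* (As :* Bq)) :- L) :* D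
                                       := Bq :* (two :* (T :* A :* As) :* D)) refl A T L D (fromℕ 2) (A ^ s) (B ^ q) ⟩
      B ^ q * (fromℕ 2 * (T * A * A ^ s) * D)
        ≡⟨ cong (λ z → B ^ q * (fromℕ 2 * z * D)) A^[t+1+s]≡N ⟩
      B ^ q * (fromℕ 2 * N * D)
        ≡⟨ trans (cong (B ^ q *_) 2ND≡1) (*-identityʳ _) ⟩
      B ^ q ∎
      where
      T = A ^ t
      φ²[TLD] : φ (φ (T * L * D)) ≡ φ (φ T) * φ (φ L) * D
      φ²[TLD] = begin
        φ (φ (T * L * D))            ≡⟨ cong φ (trans (φ-* (T * L) D) (cong (_* φ D) (φ-* T L))) ⟩
        φ (φ T * φ L * φ D)          ≡⟨ trans (φ-* (φ T * φ L) (φ D)) (cong (_* φ (φ D)) (φ-* (φ T) (φ L))) ⟩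
        φ (φ T) * φ (φ L) * φ (φ D)  ≡⟨ cong (φ (φ T) * φ (φ L) *_) (trans (cong φ φD≡D) φD≡D) ⟩
        φ (φ T) * φ (φ L) * D        ∎

    -Ay^[q+1]≡X : - (A * y ^ (q ℕ.+ 1)) ≡ X
    -Ay^[q+1]≡X = begin
      - (A * y ^ (q ℕ.+ 1))
        ≡⟨ cong (λ z → - (A * z)) (-‿^[q+1] (T * L * D)) ⟩
      - (A * (T * L * D) ^ (q ℕ.+ 1))
        ≡⟨ cong (λ z → - (A * z)) (trans (^-distrib-* (T * L) D (q ℕ.+ 1)) (cong (_* D ^ (q ℕ.+ 1)) (^-distrib-* T L (q ℕ.+ 1)))) ⟩
      - (A * (T ^ (q ℕ.+ 1) * L ^ (q ℕ.+ 1) * D ^ (q ℕ.+ 1)))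
        ≡⟨ cong (λ z → - (A * (T ^ (q ℕ.+ 1) * L ^ (q ℕ.+ 1) * z))) (trans (^[q+1]≡^q* D) (cong (_* D) φD≡D)) ⟩
      - (A * (T ^ (q ℕ.+ 1) * L ^ (q ℕ.+ 1) * (D * D)))
        ≡⟨ solve 4 (λ A T′ L′ D → :- (A :* (T′ :* L′ :* (D :* D))) := :- L′ :* ((A :* T′) :* D :* D)) refl A (T ^ (q ℕ.+ 1)) (L ^ (q ℕ.+ 1)) D ⟩
      - (L ^ (q ℕ.+ 1)) * ((A * T ^ (q ℕ.+ 1)) * D * D)
        ≡⟨ cong (λ z → - (L ^ (q ℕ.+ 1)) * (z * D * D)) A^[1+t[q+1]]≡N ⟩
      - (L ^ (q ℕ.+ 1)) * (N * D * D)
        ≡⟨ cong (- (L ^ (q ℕ.+ 1)) *_) (⁻¹-unique (fromℕ 4 * N) (N * D * D) 4N[NDD]≡1) ⟩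
      X ∎
      where
      T = A ^ t
      4N[NDD]≡1 : fromℕ 4 * N * (N * D * D) ≡ 1#
      4N[NDD]≡1 = begin
        fromℕ 4 * N * (N * D * D)              ≡⟨ cong (λ z → z * N * (N * D * D)) (fromℕ-* 2 2) ⟩
        fromℕ 2 * fromℕ 2 * N * (N * D * D)    ≡⟨ solve 3 (λ two N D → two :* two :* N :* (N :* D :* D) := (two :* N :* D) :* (two :* N :* D)) refl (fromℕ 2) N D ⟩
        (fromℕ 2 * N * D) * (fromℕ 2 * N * D)  ≡⟨ cong₂ _*_ 2ND≡1 2ND≡1 ⟩
        1# * 1#                                ≡⟨ *-identityˡ 1# ⟩
        1#                                     ∎

    -- Tr is invariant under φ, so the cross terms add up to Tr ((A y + A^q y^(q²)) w^q).
    Tr-cross-terms : ∀ w → Tr (A * y * φ w + A * φ y * w) ≡ Tr (B * w)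
    Tr-cross-terms w = begin
      Tr (A * y * φ w + A * φ y * w)                 ≡⟨ Tr-+ _ _ ⟩
      Tr (A * y * φ w) + Tr (A * φ y * w)            ≡⟨ cong (Tr (A * y * φ w) +_) (sym (Tr-^q (A * φ y * w))) ⟩
      Tr (A * y * φ w) + Tr (φ (A * φ y * w))        ≡⟨ cong (λ z → Tr (A * y * φ w) + Tr z) (trans (φ-* (A * φ y) w) (cong (_* φ w) (φ-* A (φ y)))) ⟩
      Tr (A * y * φ w) + Tr (A ^ q * φ (φ y) * φ w)  ≡⟨ sym (Tr-+ _ _) ⟩
      Tr (A * y * φ w + A ^ q * φ (φ y) * φ w)       ≡⟨ cong Tr (sym (distribʳ (φ w) (A * y) (A ^ q * φ (φ y)))) ⟩
      Tr ((A * y + A ^ q * φ (φ y)) * φ w)           ≡⟨ cong (λ z → Tr (z * φ w)) Ay+A^qφ²y≡B^q ⟩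
      Tr (B ^ q * φ w)                               ≡⟨ cong Tr (sym (φ-* B w)) ⟩
      Tr (φ (B * w))                                 ≡⟨ Tr-^q (B * w) ⟩
      Tr (B * w)                                     ∎

    Tr-shift : ∀ w → Tr (A * (w + y) ^ (q ℕ.+ 1)) ≡ Tr (A * w ^ (q ℕ.+ 1) + B * w) + Tr (A * y ^ (q ℕ.+ 1))
    Tr-shift w = begin
      Tr (A * (w + y) ^ (q ℕ.+ 1))
        ≡⟨ cong Tr expand ⟩
      Tr ((A * w ^ (q ℕ.+ 1) + (A * y * φ w + A * φ y * w)) + A * y ^ (q ℕ.+ 1))
        ≡⟨ Tr-+ _ _ ⟩
      Tr (A * w ^ (q ℕ.+ 1) + (A * y * φ w + A * φ y * w)) + Tr (A * y ^ (q ℕ.+ 1))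
        ≡⟨ cong (_+ Tr (A * y ^ (q ℕ.+ 1))) (trans (Tr-+ _ _) (trans (cong (Tr (A * w ^ (q ℕ.+ 1)) +_) (Tr-cross-terms w)) (sym (Tr-+ _ _)))) ⟩
      Tr (A * w ^ (q ℕ.+ 1) + B * w) + Tr (A * y ^ (q ℕ.+ 1)) ∎
      where
      expand : A * (w + y) ^ (q ℕ.+ 1) ≡ (A * w ^ (q ℕ.+ 1) + (A * y * φ w + A * φ y * w)) + A * y ^ (q ℕ.+ 1)
      expand = begin
        A * (w + y) ^ (q ℕ.+ 1)
          ≡⟨ cong (A *_) (trans (^[q+1]≡^q* (w + y)) (cong (_* (w + y)) (frobenius-q w y))) ⟩
        A * ((φ w + φ y) * (w + y))
          ≡⟨ solve 5 (λ A w y w′ y′ → A :* ((w′ :+ y′) :* (w :+ y))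
                                    := (A :* (w′ :* w) :+ (A :* y :* w′ :+ A :* y′ :* w)) :+ A :* (y′ :* y))
                     refl A w y (φ w) (φ y) ⟩
        (A * (φ w * w) + (A * y * φ w + A * φ y * w)) + A * (φ y * y)
          ≡⟨ cong₂ (λ a b → (A * a + (A * y * φ w + A * φ y * w)) + A * b) (sym (^[q+1]≡^q* w)) (sym (^[q+1]≡^q* y)) ⟩
        (A * w ^ (q ℕ.+ 1) + (A * y * φ w + A * φ y * w)) + A * y ^ (q ℕ.+ 1) ∎

module WeilSum {c ℓ : Level} (F : FiniteField) (p : ℕ) (p-prime : Prime p) (E : ℕ)
    (size≡p^E : FiniteField.size F ≡ p ℕ.^ E)
    (R : CommutativeRing c ℓ) (ζ : CommutativeRing.Carrier R)
    (geomSum≡0 : CommutativeRing._≈_ R (Characters.geomSum R F ζ p) (CommutativeRing.0# R)) (2<p : 2 < p)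
    (m q : ℕ) (q≡p^m : q ≡ p ℕ.^ m) (n k : ℕ) (n≡1+2k : n ≡ suc (2 ℕ.* k))
    (size≡q^n : FiniteField.size F ≡ q ℕ.^ n) (r : ℕ) (q+1≡2r : q ℕ.+ 1 ≡ 2 ℕ.* r) where
  module 𝔽 = Field F
  open 𝔽 using (Carrier; _+_; _*_; -_; 0#; _^_; _≟_; elements; unique; complete; solve; _:=_; _:+_; _:-_; :-_)
  open Squares F (PrimeCharacteristic.fromℕ-nonzero F p p-prime E size≡p^E (s≤s z≤n) 2<p)
  open QPlusOnePower F p p-prime E size≡p^E 2<p m q q≡p^m n k n≡1+2k size≡q^n r q+1≡2r
  open AdditiveCharacter F p p-prime E size≡p^E R ζ geomSum≡0 using (ψ; ψ-+; ψ-cong-Tr; ∑ψ[A*]≈0)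
  open PrimeCharacteristic F p p-prime E size≡p^E using (Tr; Tr-+)
  open CompletingTheSquare F p p-prime E size≡p^E 2<p m q q≡p^m n k n≡1+2k size≡q^n r q+1≡2r using (y; X; -Ay^[q+1]≡X; Tr-shift)
  open QuadraticCharacter F p p-prime E size≡p^E R ζ geomSum≡0 2<p using (η-0; η-square; η-nonsquare; gauss-twist)
  open CommutativeRing R renaming
    (Carrier to Rc; _+_ to _+ᴿ_; _*_ to _*ᴿ_; -_ to -ᴿ_; 0# to 0ᴿ; 1# to 1ᴿ)
  open RingSums R
  open Characters R F using (η; ΣF; gauss)
  open import Relation.Binary.Reasoning.Setoid setoid

  private
    count-preimages : Carrier → Rc → Rc
    count-preimages c v = ∑ (λ w → indicator ((w ^ (q ℕ.+ 1)) ≟ c) v) elements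

    count-preimages-0 : ∀ v → count-preimages 0# v ≈ (1ᴿ +ᴿ η 0#) *ᴿ v
    count-preimages-0 v = begin
      ∑ (λ w → indicator ((w ^ (q ℕ.+ 1)) ≟ 0#) v) elements
        ≈⟨ ∑-cong elements (λ w → indicator-⇔ ((w ^ (q ℕ.+ 1)) ≟ 0#) (w ≟ 0#) v
             (𝔽.^≡0⇒≡0 w (q ℕ.+ 1)) (λ { ≡.refl → 𝔽.0^n≡0 (ℕP.m≤n+m 1 q) })) ⟩
      ∑ (λ w → indicator (w ≟ 0#) v) elements
        ≈⟨ ∑-indicator _≟_ 0# (λ _ → v) elements unique (complete 0#) ⟩
      v
        ≈⟨ *-identityˡ v ⟨
      1ᴿ *ᴿ v
        ≈⟨ *-congʳ (trans (+-congˡ (reflexive η-0)) (+-identityʳ 1ᴿ)) ⟨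
      (1ᴿ +ᴿ η 0#) *ᴿ v ∎

    -- The preimages of c = v₀^(q+1) are v₀ and - v₀.
    count-preimages-square : ∀ {c} v → c ≢ 0# → IsSquare c → count-preimages c v ≈ (1ᴿ +ᴿ η c) *ᴿ v
    count-preimages-square {c} v c≢0 c□ = begin
      ∑ (λ w → indicator ((w ^ (q ℕ.+ 1)) ≟ c) v) elements
        ≈⟨ ∑-cong elements split ⟩
      ∑ (λ w → indicator (w ≟ v₀) v +ᴿ indicator (w ≟ (- v₀)) v) elements
        ≈⟨ ∑-distrib (λ w → indicator (w ≟ v₀) v) (λ w → indicator (w ≟ (- v₀)) v) elements ⟩
      ∑ (λ w → indicator (w ≟ v₀) v) elements +ᴿ ∑ (λ w → indicator (w ≟ (- v₀)) v) elements
        ≈⟨ +-cong (∑-indicator _≟_ v₀ (λ _ → v) elements unique (complete v₀))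
                  (∑-indicator _≟_ (- v₀) (λ _ → v) elements unique (complete (- v₀))) ⟩
      v +ᴿ v
        ≈⟨ +-cong (*-identityˡ v) (*-identityˡ v) ⟨
      1ᴿ *ᴿ v +ᴿ 1ᴿ *ᴿ v
        ≈⟨ distribʳ v 1ᴿ 1ᴿ ⟨
      (1ᴿ +ᴿ 1ᴿ) *ᴿ v
        ≡⟨ cong (λ t → (1ᴿ +ᴿ t) *ᴿ v) (≡.sym (η-square c≢0 c□)) ⟩
      (1ᴿ +ᴿ η c) *ᴿ v ∎
      where
      root = square⇒^[q+1] c c≢0 c□
      v₀ = proj₁ root
      v₀≢0 = proj₁ (proj₂ root)
      v₀^[q+1]≡c = proj₂ (proj₂ root)
      split : ∀ w → indicator ((w ^ (q ℕ.+ 1)) ≟ c) v ≈ indicator (w ≟ v₀) v +ᴿ indicator (w ≟ (- v₀)) v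
      split w with w ≟ v₀ | w ≟ (- v₀) | (w ^ (q ℕ.+ 1)) ≟ c
      ... | yes ≡.refl | yes w≡-w | _     = ⊥-elim (x≢-x w v₀≢0 w≡-w)
      ... | yes ≡.refl | no _     | yes _ = sym (+-identityʳ v)
      ... | yes ≡.refl | no _     | no ≢c = ⊥-elim (≢c v₀^[q+1]≡c)
      ... | no _       | yes ≡.refl | yes _ = sym (+-identityˡ v)
      ... | no _       | yes ≡.refl | no ≢c = ⊥-elim (≢c (≡.trans (-‿^[q+1] v₀) v₀^[q+1]≡c))
      ... | no w≢v₀    | no w≢-v₀ | yes ≡c =
        ⊥-elim ([ w≢v₀ , w≢-v₀ ]′ (^[q+1]-injective-up-to-sign v₀≢0 (≡.trans ≡c (≡.sym v₀^[q+1]≡c))))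
      ... | no _       | no _     | no _  = sym (+-identityˡ 0ᴿ)

    -- Every (q + 1)-th power is a square.
    count-preimages-nonsquare : ∀ {c} v → c ≢ 0# → ¬ IsSquare c → count-preimages c v ≈ (1ᴿ +ᴿ η c) *ᴿ v
    count-preimages-nonsquare {c} v c≢0 ¬c□ = begin
      ∑ (λ w → indicator ((w ^ (q ℕ.+ 1)) ≟ c) v) elements
        ≈⟨ ∑-cong elements none ⟩
      ∑ (λ _ → 0ᴿ) elements
        ≈⟨ ∑-ε elements ⟩
      0ᴿ
        ≈⟨ zeroˡ v ⟨
      0ᴿ *ᴿ v
        ≈⟨ *-congʳ (trans (+-congˡ (reflexive (η-nonsquare c≢0 ¬c□))) (-‿inverseʳ 1ᴿ)) ⟨
      (1ᴿ +ᴿ η c) *ᴿ v ∎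
      where
      none : ∀ w → indicator ((w ^ (q ℕ.+ 1)) ≟ c) v ≈ 0ᴿ
      none w with (w ^ (q ℕ.+ 1)) ≟ c
      ... | yes ≡c = ⊥-elim (¬c□ (subst IsSquare ≡c (subst IsSquare (≡.sym (^[q+1]≡square w)) (square-isSquare (w ^ r)))))
      ... | no _   = refl

  count-preimages-^[q+1] : ∀ c v → ∑ (λ w → indicator ((w ^ (q ℕ.+ 1)) ≟ c) v) elements ≈ (1ᴿ +ᴿ η c) *ᴿ v
  count-preimages-^[q+1] c v = by-cases (c ≟ 0#) (isSquare? c)
    where
    by-cases : Dec (c ≡ 0#) → Dec (IsSquare c) → count-preimages c v ≈ (1ᴿ +ᴿ η c) *ᴿ v
    by-cases (yes ≡.refl) _      = count-preimages-0 v
    by-cases (no c≢0)     (yes c□) = count-preimages-square v c≢0 c□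
    by-cases (no c≢0)     (no ¬c□) = count-preimages-nonsquare v c≢0 ¬c□

  ∑-∘^[q+1] : ∀ (g : Carrier → Rc) → ΣF (λ w → g (w ^ (q ℕ.+ 1))) ≈ ΣF (λ c → (1ᴿ +ᴿ η c) *ᴿ g c)
  ∑-∘^[q+1] g = begin
    ∑ (λ w → g (w ^ (q ℕ.+ 1))) elements
      ≈⟨ ∑-fibres _≟_ (_^ (q ℕ.+ 1)) (λ w → g (w ^ (q ℕ.+ 1))) elements elements unique (λ _ _ → complete _) ⟩
    ∑ (λ c → ∑ (λ w → indicator ((w ^ (q ℕ.+ 1)) ≟ c) (g (w ^ (q ℕ.+ 1)))) elements) elements
      ≈⟨ ∑-cong elements (λ c → trans (∑-cong elements (λ w → indicator-cong ((w ^ (q ℕ.+ 1)) ≟ c) (reflexive ∘ cong g)))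
                                        (count-preimages-^[q+1] c (g c))) ⟩
    ∑ (λ c → (1ᴿ +ᴿ η c) *ᴿ g c) elements ∎

  ∑ψ[Aw^[q+1]]≈ηG : ∀ A → A ≢ 0# → ΣF (λ w → ψ (A * w ^ (q ℕ.+ 1))) ≈ η A *ᴿ gauss p E ζ
  ∑ψ[Aw^[q+1]]≈ηG A A≢0 = begin
    ΣF (λ w → ψ (A * w ^ (q ℕ.+ 1)))
      ≈⟨ ∑-∘^[q+1] (λ c → ψ (A * c)) ⟩
    ∑ (λ c → (1ᴿ +ᴿ η c) *ᴿ ψ (A * c)) elements
      ≈⟨ ∑-cong elements (λ c → trans (distribʳ _ _ _) (+-congʳ (*-identityˡ _))) ⟩
    ∑ (λ c → ψ (A * c) +ᴿ η c *ᴿ ψ (A * c)) elements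
      ≈⟨ ∑-distrib (λ c → ψ (A * c)) (λ c → η c *ᴿ ψ (A * c)) elements ⟩
    ∑ (λ c → ψ (A * c)) elements +ᴿ ∑ (λ c → η c *ᴿ ψ (A * c)) elements
      ≈⟨ +-cong (∑ψ[A*]≈0 A A≢0) (gauss-twist A A≢0) ⟩
    0ᴿ +ᴿ η A *ᴿ gauss p E ζ
      ≈⟨ +-identityˡ _ ⟩
    η A *ᴿ gauss p E ζ ∎

  ψ-complete-square : ∀ A B (A≢0 : A ≢ 0#) w →
                      ψ (A * w ^ (q ℕ.+ 1) + B * w) ≈ ψ (A * (w + y A B A≢0) ^ (q ℕ.+ 1)) *ᴿ ψ (X A B A≢0)
  ψ-complete-square A B A≢0 w = begin
    ψ f
      ≡⟨ cong ψ (≡.trans (solve 2 (λ f a → f := (f :+ a) :+ (:- a)) ≡.refl f a) (cong ((f + a) +_) (-Ay^[q+1]≡X A B A≢0))) ⟩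
    ψ ((f + a) + X A B A≢0)
      ≈⟨ ψ-+ (f + a) (X A B A≢0) ⟩
    ψ (f + a) *ᴿ ψ (X A B A≢0)
      ≡⟨ cong (_*ᴿ ψ (X A B A≢0)) (ψ-cong-Tr (≡.trans (Tr-+ f a) (≡.sym (Tr-shift A B A≢0 w)))) ⟩
    ψ (A * (w + y A B A≢0) ^ (q ℕ.+ 1)) *ᴿ ψ (X A B A≢0) ∎
    where
    f = A * w ^ (q ℕ.+ 1) + B * w
    a = A * y A B A≢0 ^ (q ℕ.+ 1)

  weil-sum : ∀ A B (A≢0 : A ≢ 0#) →
             ΣF (λ w → ψ (A * w ^ (q ℕ.+ 1) + B * w)) ≈ (η A *ᴿ gauss p E ζ) *ᴿ ψ (X A B A≢0)
  weil-sum A B A≢0 = begin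
    ∑ (λ w → ψ (A * w ^ (q ℕ.+ 1) + B * w)) elements
      ≈⟨ ∑-cong elements (ψ-complete-square A B A≢0) ⟩
    ∑ (λ w → ψ (A * (w + y₀) ^ (q ℕ.+ 1)) *ᴿ ψ (X A B A≢0)) elements
      ≈⟨ ∑-distribʳ (λ w → ψ (A * (w + y₀) ^ (q ℕ.+ 1))) (ψ (X A B A≢0)) elements ⟩
    ∑ (λ w → ψ (A * (w + y₀) ^ (q ℕ.+ 1))) elements *ᴿ ψ (X A B A≢0)
      ≈⟨ *-congʳ (∑-reindex (λ w → ψ (A * w ^ (q ℕ.+ 1))) (_+ y₀) (λ w → w + - y₀) unique (λ _ → complete _) (λ _ → complete _)
           (λ w → solve 2 (λ w y → (w :+ y) :- y := w) ≡.refl w y₀) (λ w → solve 2 (λ w y → (w :- y) :+ y := w) ≡.refl w y₀)) ⟩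
    ∑ (λ w → ψ (A * w ^ (q ℕ.+ 1))) elements *ᴿ ψ (X A B A≢0)
      ≈⟨ *-congʳ (∑ψ[Aw^[q+1]]≈ηG A A≢0) ⟩
    (η A *ᴿ gauss p E ζ) *ᴿ ψ (X A B A≢0) ∎
    where y₀ = y A B A≢0

odd⇒≡1+2[n/2] : ∀ n → n % 2 ≡ 1 → n ≡ suc (2 ℕ.* (n / 2))
odd⇒≡1+2[n/2] n n%2≡1 = ≡.trans (m≡m%n+[m/n]*n n 2) (≡.trans (cong (ℕ._+ (n / 2) ℕ.* 2) n%2≡1) (cong suc (ℕP.*-comm (n / 2) 2)))

odd⇒1+n≡2[1+n/2] : ∀ n → n % 2 ≡ 1 → n ℕ.+ 1 ≡ 2 ℕ.* suc (n / 2)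
odd⇒1+n≡2[1+n/2] n n%2≡1 = ≡.trans (cong (ℕ._+ 1) (odd⇒≡1+2[n/2] n n%2≡1)) (identity (n / 2))
  where
  identity : ∀ a → suc (2 ℕ.* a) ℕ.+ 1 ≡ 2 ℕ.* suc a
  identity = solve-∀

odd-prime-power⇒2<p : ∀ {p m} → Prime p → 1 ≤ m → (p ℕ.^ m) % 2 ≡ 1 → 2 < p
odd-prime-power⇒2<p {p} {suc m} p-prime _ odd = ℕP.≤∧≢⇒< (ℕ.nonTrivial⇒n>1 p {{prime⇒nonTrivial p-prime}}) 2≢p
  where
  2≢p : 2 ≢ p
  2≢p ≡.refl with ≡.trans (≡.sym (m*n%n≡0 (2 ℕ.^ m) 2)) (≡.trans (cong (_% 2) (ℕP.*-comm (2 ℕ.^ m) 2)) odd)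
  ... | ()

open Data.Nat using (_^_)

mainTheorem8 : ∀ {c ℓ : Level} (p m q n : ℕ) → Prime p → 1 Data.Nat.≤ m → q ≡ p ^ m →
    q % 2 ≡ 1 → n % 2 ≡ 1 →
    (F : FiniteField) → FiniteField.size F ≡ q ^ n →
    (R : CommutativeRing c ℓ) (ζ : CommutativeRing.Carrier R) →
    CommutativeRing._≈_ R (Characters.geomSum R F ζ p) (CommutativeRing.0# R) →
    (A B : FiniteField.Carrier F) → A ≢ FiniteField.0# F →
    let open FiniteField F renaming (_^_ to _^ᶠ_)
        open Characters R F
        open CommutativeRing R using (_≈_) renaming (_*_ to _*ᴿ_)
        e = m Data.Nat.* n
        s = sExp q (n / 2)
        X = - ((lam q n ((A ^ᶠ s) * (B ^ᶠ q))) ^ᶠ (q Data.Nat.+ 1))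
              * ((fromℕ 4 * Π< n (λ i → A ^ᶠ (q ^ i))) ⁻¹)
    in ΣF (λ w → χ p e ζ ((A * (w ^ᶠ (q Data.Nat.+ 1))) + (B * w)))
         ≈ ((η A *ᴿ gauss p e ζ) *ᴿ χ p e ζ X)
mainTheorem8 p m q n p-prime 1≤m q≡p^m q-odd n-odd F size≡q^n R ζ geomSum≡0 A B A≢0 =
  WeilSum.weil-sum F p p-prime (m ℕ.* n) size≡p^[mn] R ζ geomSum≡0 2<p m q q≡p^m n (n / 2) (odd⇒≡1+2[n/2] n n-odd)
                   size≡q^n (suc (q / 2)) (odd⇒1+n≡2[1+n/2] q q-odd) A B A≢0
  where
  size≡p^[mn] : FiniteField.size F ≡ p ^ (m ℕ.* n)
  size≡p^[mn] = ≡.trans size≡q^n (≡.trans (cong (_^ n) q≡p^m) (ℕP.^-*-assoc p m n))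
  2<p : 2 < p
  2<p = odd-prime-power⇒2<p p-prime 1≤m (≡.trans (cong (_% 2) (≡.sym q≡p^m)) q-odd)
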